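{- For every positive integer $n$, the map $\phi^{\mathrm{den}}_n:\mathfrak{S}_{n-1}\times\{0,1,\dots,n-1\}\to\mathfrak{S}_n$ defined in the context is a bijection.
   Context: Permutations are in one-line notation. A position $i$ of $\sigma$ is an excedance if $\sigma_i>i$, a non-excedance otherwise; letters at excedances are excedance-letters; $\mathsf{exc}(\sigma)$ is the number of excedances. The map $\phi^{\mathrm{den}}_n$: let $\sigma=\sigma_1\cdots\sigma_{n-1}\in\mathfrak{S}_{n-1}$, $0\le c\le n-1$, $s=\mathsf{exc}(\sigma)$, let $e_1<\dots<e_s$ be the excedance-letters of $\sigma$, and $k_1<\dots<k_t$ the non-excedances of $\sigma$; set $k_{t+1}=n$. The image $w=w_1\cdots w_n$ is defined as follows. Case $c=0$: $w=\sigma_1\cdots\sigma_{n-1}n$. Case $1\le c\le s$: let $d=s+1-c$. Let $e_{j_1}<\dots<e_{j_x}$ be the excedance-letters of $\sigma$ located at positions strictly less than $e_d$ and with value at least $e_d$ (so $e_{j_1}=e_d$), and set $e_{j_{x+1}}=n$. Let $y$ be the least index with $k_y\geq e_d$. Step 1: replace each letter $e_{j_i}$ by $e_{j_{i+1}}$ ($i=1,\dots,x$). Step 2: for $i=y+1,\dots,t+1$, put the letter $\sigma_{k_{i-1}}$ at position $k_i$. Step 3: put $e_d$ at position $k_y$. All other positions keep the letter of $\sigma$. Case $s+1\le c\le n-1$: let $d=c-s$. For $i=d+1,\dots,t+1$, put $\sigma_{k_{i-1}}$ at position $k_i$; put $n$ at position $k_d$; all other positions keep the letter of $\sigma$. 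-}

module Defs where

open import Data.Nat using (ℕ; zero; suc; _∸_; _<ᵇ_; _≡ᵇ_; _≤ᵇ_)
open import Data.Bool using (Bool; true; false; if_then_else_; _∧_; not)
open import Data.List using (List; []; _∷_; map; upTo; filterᵇ; length; _++_)
open import Data.Bool.ListAction using (any)
open import Data.List.Relation.Binary.Permutation.Propositional using (_↭_)

range1 : ℕ → List ℕ
range1 m = map suc (upTo m)

-- A permutation of {1,...,m} in one-line notation.
IsPerm : ℕ → List ℕ → Set
IsPerm m xs = xs ↭ range1 m

-- 1-indexed lookup (default 0 out of range)
at : List ℕ → ℕ → ℕ
at []       _             = 0
at (x ∷ xs) zero          = 0
at (x ∷ xs) (suc zero)    = x
at (x ∷ xs) (suc (suc i)) = at xs (suc i)

elemᵇ : ℕ → List ℕ → Bool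
elemᵇ v xs = any (λ x → v ≡ᵇ x) xs

-- 1-indexed position of the first occurrence of v in xs (0 if absent)
indexOf : ℕ → List ℕ → ℕ
indexOf v []       = 0
indexOf v (x ∷ xs) = if v ≡ᵇ x then 1 else (if elemᵇ v xs then suc (indexOf v xs) else 0)

-- 1-indexed index of the first entry ≥ e (0 if none)
firstGeq : ℕ → List ℕ → ℕ
firstGeq e []       = 0
firstGeq e (x ∷ xs) = if e ≤ᵇ x then 1 else (if any (λ z → e ≤ᵇ z) xs then suc (firstGeq e xs) else 0)

nextIn : ℕ → List ℕ → ℕ → ℕ
nextIn n []           v = v
nextIn n (a ∷ [])     v = if v ≡ᵇ a then n else v
nextIn n (a ∷ b ∷ cs) v = if v ≡ᵇ a then b else nextIn n (b ∷ cs) v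

module _ (σ : List ℕ) where
  excPos : List ℕ
  excPos = filterᵇ (λ i → i <ᵇ at σ i) (range1 (length σ))

  nonExcPos : List ℕ
  nonExcPos = filterᵇ (λ i → not (i <ᵇ at σ i)) (range1 (length σ))

  exc : ℕ
  exc = length excPos

  excLetters : List ℕ
  excLetters = filterᵇ (λ v → elemᵇ v (map (at σ) excPos)) (range1 (length σ))

phiDen : ℕ → List ℕ → ℕ → List ℕ
phiDen n σ zero = σ ++ (n ∷ [])
phiDen n σ (suc c') = if c ≤ᵇ s then caseA else caseB
  where
  c = suc c'
  s = exc σ
  K : List ℕ
  K = nonExcPos σ ++ (n ∷ [])
  d = suc s ∸ c
  ed = at (excLetters σ) d
  chain : List ℕ
  chain = filterᵇ (λ v → elemᵇ v (map (at σ) (filterᵇ (λ i → (i <ᵇ ed) ∧ (ed ≤ᵇ at σ i)) (excPos σ))))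
                  (range1 (length σ))
  y = firstGeq ed K
  wA : ℕ → ℕ
  wA p = if elemᵇ p K
           then (let i = indexOf p K in
                 if y <ᵇ i then at σ (at K (i ∸ 1))
                 else if i ≡ᵇ y then ed
                 else at σ p)
           else (if elemᵇ (at σ p) chain then nextIn n chain (at σ p) else at σ p)
  caseA = map wA (range1 n)
  d' = c ∸ s
  wB : ℕ → ℕ
  wB p = if elemᵇ p K
           then (let i = indexOf p K in
                 if d' <ᵇ i then at σ (at K (i ∸ 1))
                 else if i ≡ᵇ d' then n
                 else at σ p)
           else at σ p
  caseB = map wB (range1 n)

-- φ factors into a permutation of positions and one of values. Let σ̂ = σ₁ ⋯ σ_{n-1} n (Shat below), let
-- k₁ < ⋯ < k_t be the nonexcedances of σ and k_{t+1} = n. For c = 0 or c > s, φ(σ, c) = σ̂ ∘ slide, where slide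
-- sends k_i to k_{i-1} for i > d and k_d to n (d = t + 1 resp. c − s); for 1 ≤ c ≤ s, φ(σ, c) = cycle ∘ σ̂ ∘ slide
-- with slide taken at d = y and cycle the cyclic permutation (n e_d e_{j_2} ⋯ e_{j_x}) of the chain letters.
-- So φ(σ, c) is a permutation. For bijectivity an inverse ψ is written down: in w = φ(σ, c) the letter n,
-- the nonexcedance positions and the last "rise" among them (the place where Step 3 put e_d) locate the
-- slide, the chain and the case, and undoing the two factors returns (σ, c).

module Submission where

open import Defs
open import Data.Nat using (ℕ; zero; suc; _+_; _∸_; _≤_; _<_; z≤n; s≤s; _<ᵇ_; _≤ᵇ_; _≡ᵇ_; _≟_)
open import Data.Nat.Properties
open import Data.Bool using (Bool; true; false; if_then_else_; _∧_; _∨_; not; T)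
open import Data.Bool.Properties using (T?; if-float)
open import Data.Bool.ListAction using (any)
open import Data.List.Relation.Unary.Any.Properties using (any⁺)
open import Data.Unit using (tt)
open import Data.Empty using (⊥; ⊥-elim)
open import Data.Product using (_×_; _,_; proj₁; proj₂; ∃-syntax)
open import Data.Sum using (_⊎_; inj₁; inj₂)
open import Data.List using (List; []; _∷_; map; applyUpTo; filterᵇ; length; drop; _++_; [_])
open import Data.List.Properties using (length-applyUpTo; map-applyUpTo; applyUpTo-∷ʳ; length-++; length-map)
open import Data.List.Relation.Unary.Any as Any using (here; there)
open import Data.List.Relation.Unary.All as All using (All; []; _∷_)
open import Data.List.Relation.Unary.AllPairs as AP using (AllPairs; []; _∷_)
open import Data.List.Relation.Unary.AllPairs.Properties using (applyUpTo⁺₁) renaming (filter⁺ to AllPairs-filter⁺)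
open import Data.List.Relation.Unary.Unique.Propositional using (Unique)
open import Data.List.Membership.Propositional using (_∈_; _∉_)
open import Data.List.Membership.Propositional.Properties
  using (∈-++⁺ˡ; ∈-++⁺ʳ; ∈-++⁻; ∈-∃++; ∈-map⁻; ∈-map⁺; ∈-applyUpTo⁺; ∈-applyUpTo⁻; ∈-filter⁺; ∈-filter⁻)
open import Data.List.Membership.DecPropositional _≟_ using (_∈?_)
open import Data.List.Relation.Binary.Permutation.Propositional using (_↭_; ↭-sym; ↭⇒↭ₛ)
open import Data.List.Relation.Binary.Permutation.Propositional.Properties using (↭-length; ∈-resp-↭; ++⁺ʳ)
import Data.List.Relation.Binary.Permutation.Setoid.Properties as PermutationSetoid
open import Data.List.Relation.Binary.BagAndSetEquality using (∼bag⇒↭)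
open import Data.List.Membership.Propositional.Properties.WithK using (unique∧set⇒bag)
open import Function using (_∘_)
open import Function.Bundles using (mk⇔)
open import Relation.Binary.PropositionalEquality hiding ([_])
open import Relation.Binary.Definitions using (tri<; tri≈; tri>)
open import Relation.Nullary using (¬_; yes; no; Dec)

if-T : ∀ {A : Set} {b} {x y : A} → T b → (if b then x else y) ≡ x
if-T {b = true} _ = refl

if-¬T : ∀ {A : Set} {b} {x y : A} → ¬ T b → (if b then x else y) ≡ y
if-¬T {b = false} _ = refl
if-¬T {b = true} h = ⊥-elim (h tt)

if-cong-T : ∀ {b} {x x' y y' : ℕ} → (T b → x ≡ x') → (¬ T b → y ≡ y') →
            (if b then x else y) ≡ (if b then x' else y')
if-cong-T {true} f g = f tt
if-cong-T {false} f g = g (λ ())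

T-∧ : ∀ {a b} → T (a ∧ b) → T a × T b
T-∧ {true} {true} _ = tt , tt

∧-T : ∀ {a b} → T a → T b → T (a ∧ b)
∧-T {true} {true} _ _ = tt

T-∨ : ∀ {a b} → T (a ∨ b) → T a ⊎ T b
T-∨ {true} _ = inj₁ tt
T-∨ {false} {true} _ = inj₂ tt

∨-Tˡ : ∀ {a b} → T a → T (a ∨ b)
∨-Tˡ {true} _ = tt

∨-Tʳ : ∀ {a b} → T b → T (a ∨ b)
∨-Tʳ {true} _ = tt
∨-Tʳ {false} {true} _ = tt

not-T : ∀ {a} → ¬ T a → T (not a)
not-T {false} _ = tt
not-T {true} h = ⊥-elim (h tt)

T-not : ∀ {a} → T (not a) → ¬ T a
T-not {false} _ ()

T-<ᵇ : ∀ {m n} → T (m <ᵇ n) → m < n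
T-<ᵇ {m} {n} = <ᵇ⇒< m n

T-≤ᵇ : ∀ {m n} → T (m ≤ᵇ n) → m ≤ n
T-≤ᵇ {m} {n} = ≤ᵇ⇒≤ m n

≡ᵇ-T : ∀ {m n} → m ≡ n → T (m ≡ᵇ n)
≡ᵇ-T {m} {n} = ≡⇒≡ᵇ m n

T-≡ᵇ : ∀ {m n} → T (m ≡ᵇ n) → m ≡ n
T-≡ᵇ {m} {n} = ≡ᵇ⇒≡ m n

¬<ᵇ : ∀ {m n} → n ≤ m → ¬ T (m <ᵇ n)
¬<ᵇ n≤m h = <⇒≱ (T-<ᵇ h) n≤m

¬≤ᵇ : ∀ {m n} → n < m → ¬ T (m ≤ᵇ n)
¬≤ᵇ n<m h = <⇒≱ n<m (T-≤ᵇ h)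

¬≡ᵇ : ∀ {m n} → m ≢ n → ¬ T (m ≡ᵇ n)
¬≡ᵇ m≢n h = m≢n (T-≡ᵇ h)

elemᵇ⇒∈ : ∀ {v xs} → T (elemᵇ v xs) → v ∈ xs
elemᵇ⇒∈ {v} {x ∷ xs} h with T-∨ {v ≡ᵇ x} h
... | inj₁ e = here (T-≡ᵇ e)
... | inj₂ e = there (elemᵇ⇒∈ e)

∈⇒elemᵇ : ∀ {v xs} → v ∈ xs → T (elemᵇ v xs)
∈⇒elemᵇ {v} = any⁺ (v ≡ᵇ_) ∘ Any.map ≡ᵇ-T

∉⇒¬elemᵇ : ∀ {v xs} → v ∉ xs → ¬ T (elemᵇ v xs)
∉⇒¬elemᵇ h t = h (elemᵇ⇒∈ t)

InRange : ℕ → ℕ → Set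
InRange N v = 1 ≤ v × v ≤ N

Increasing : List ℕ → Set
Increasing = AllPairs _<_

Increasing⇒Unique : ∀ {xs} → Increasing xs → Unique xs
Increasing⇒Unique = AP.map <⇒≢

range1-applyUpTo : ∀ N → range1 N ≡ applyUpTo suc N
range1-applyUpTo N = map-applyUpTo (λ x → x) suc N

map-range1 : ∀ (f : ℕ → ℕ) N → map f (range1 N) ≡ applyUpTo (λ i → f (suc i)) N
map-range1 f N = trans (cong (map f) (range1-applyUpTo N)) (map-applyUpTo suc f N)

length-range1 : ∀ N → length (range1 N) ≡ N
length-range1 N = trans (cong length (range1-applyUpTo N)) (length-applyUpTo suc N)

length-map-range1 : ∀ (f : ℕ → ℕ) N → length (map f (range1 N)) ≡ N
length-map-range1 f N = trans (length-map f (range1 N)) (length-range1 N)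

range1-snoc : ∀ N → range1 (suc N) ≡ range1 N ++ [ suc N ]
range1-snoc N = begin
  range1 (suc N)                ≡⟨ range1-applyUpTo (suc N) ⟩
  applyUpTo suc (suc N)         ≡⟨ applyUpTo-∷ʳ suc N ⟨
  applyUpTo suc N ++ [ suc N ]  ≡⟨ cong (_++ [ suc N ]) (range1-applyUpTo N) ⟨
  range1 N ++ [ suc N ]         ∎
  where open ≡-Reasoning

range1-increasing : ∀ N → Increasing (range1 N)
range1-increasing N rewrite range1-applyUpTo N = applyUpTo⁺₁ suc N (λ i<j _ → s≤s i<j)

∈-range1⁻ : ∀ {N v} → v ∈ range1 N → InRange N v
∈-range1⁻ {N} h rewrite range1-applyUpTo N with ∈-applyUpTo⁻ suc h
... | i , i<N , refl = s≤s z≤n , i<N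

∈-range1⁺ : ∀ {N v} → InRange N v → v ∈ range1 N
∈-range1⁺ {N} {suc v} (_ , v<N) rewrite range1-applyUpTo N = ∈-applyUpTo⁺ suc v<N

∈-filterR⁻ : ∀ {P : ℕ → Bool} {N v} → v ∈ filterᵇ P (range1 N) → InRange N v × T (P v)
∈-filterR⁻ {P} h with v∈ , Pv ← ∈-filter⁻ (T? ∘ P) h = ∈-range1⁻ v∈ , Pv

∈-filterR⁺ : ∀ {P : ℕ → Bool} {N v} → InRange N v → T (P v) → v ∈ filterᵇ P (range1 N)
∈-filterR⁺ {P} r = ∈-filter⁺ (T? ∘ P) (∈-range1⁺ r)

Increasing-filterR : ∀ (P : ℕ → Bool) N → Increasing (filterᵇ P (range1 N))
Increasing-filterR P N = AllPairs-filter⁺ (T? ∘ P) (range1-increasing N)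

length-filter-split : ∀ (P : ℕ → Bool) xs →
                      length (filterᵇ P xs) + length (filterᵇ (λ i → not (P i)) xs) ≡ length xs
length-filter-split P [] = refl
length-filter-split P (x ∷ xs) with P x
... | true = cong suc (length-filter-split P xs)
... | false = trans (+-suc (length (filterᵇ P xs)) _) (cong suc (length-filter-split P xs))

Increasing-∷ʳ : ∀ {xs} a → Increasing xs → (∀ v → v ∈ xs → v < a) → Increasing (xs ++ [ a ])
Increasing-∷ʳ {[]} a _ _ = [] ∷ []
Increasing-∷ʳ {x ∷ xs} a (px ∷ ix) h = All.tabulate x<v ∷ Increasing-∷ʳ a ix (λ v v∈ → h v (there v∈))
  where
  x<v : ∀ {v} → v ∈ xs ++ [ a ] → x < v
  x<v {v} v∈ with ∈-++⁻ xs v∈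
  ... | inj₁ q = All.lookup px q
  ... | inj₂ (here refl) = h x (here refl)

Increasing-∷ʳ⇒< : ∀ {xs : List ℕ} {n v} → Increasing (xs ++ [ n ]) → v ∈ xs → v < n
Increasing-∷ʳ⇒< {x ∷ xs} (px ∷ _) (here refl) = All.lookup px (∈-++⁺ʳ xs (here refl))
Increasing-∷ʳ⇒< {x ∷ xs} (_ ∷ i) (there h) = Increasing-∷ʳ⇒< i h

Increasing-++⁻ˡ : ∀ {xs ys : List ℕ} → Increasing (xs ++ ys) → Increasing xs
Increasing-++⁻ˡ {[]} _ = []
Increasing-++⁻ˡ {x ∷ xs} (px ∷ i) = All.tabulate (λ h → All.lookup px (∈-++⁺ˡ h)) ∷ Increasing-++⁻ˡ i

∈-snoc⁻ : ∀ {xs : List ℕ} {a v : ℕ} → v ∈ xs ++ [ a ] → v ∈ xs ⊎ v ≡ a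
∈-snoc⁻ {xs} h with ∈-++⁻ xs h
... | inj₁ q = inj₁ q
... | inj₂ (here refl) = inj₂ refl

∈-snoc-last : ∀ (xs : List ℕ) (a : ℕ) → a ∈ xs ++ [ a ]
∈-snoc-last xs a = ∈-++⁺ʳ xs (here refl)

Increasing-ext : ∀ {xs ys} → Increasing xs → Increasing ys →
                 (∀ v → v ∈ xs → v ∈ ys) → (∀ v → v ∈ ys → v ∈ xs) → xs ≡ ys
Increasing-ext {[]} {[]} _ _ _ _ = refl
Increasing-ext {[]} {y ∷ ys} _ _ _ h with () ← h y (here refl)
Increasing-ext {x ∷ xs} {[]} _ _ h _ with () ← h x (here refl)
Increasing-ext {x ∷ xs} {y ∷ ys} (px ∷ ix) (py ∷ iy) xs⊆ys ys⊆xs =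
  cong₂ _∷_ x≡y (Increasing-ext ix iy (tail-⊆ px py x≡y xs⊆ys) (tail-⊆ py px (sym x≡y) ys⊆xs))
  where
  head-≤ : ∀ {z zs} → All (z <_) zs → ∀ {v} → v ∈ z ∷ zs → z ≤ v
  head-≤ pz (here refl) = ≤-refl
  head-≤ pz (there h) = <⇒≤ (All.lookup pz h)
  x≡y : x ≡ y
  x≡y = ≤-antisym (head-≤ px (ys⊆xs y (here refl))) (head-≤ py (xs⊆ys x (here refl)))
  tail-⊆ : ∀ {z zs u us} → All (z <_) zs → All (u <_) us → z ≡ u →
           (∀ v → v ∈ z ∷ zs → v ∈ u ∷ us) → ∀ v → v ∈ zs → v ∈ us
  tail-⊆ pz pu refl h v v∈ with h v (there v∈)
  ... | here refl = ⊥-elim (<-irrefl refl (All.lookup pz v∈))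
  ... | there r = r

Increasing-head : ∀ {L e} → Increasing L → e ∈ L → (∀ x → x ∈ L → e ≤ x) → L ≡ e ∷ drop 1 L
Increasing-head {x ∷ xs} (px ∷ _) (here refl) _ = refl
Increasing-head {x ∷ xs} (px ∷ _) (there h) mn = ⊥-elim (<⇒≱ (All.lookup px h) (mn x (here refl)))

at-applyUpTo : ∀ (f : ℕ → ℕ) N i → i < N → at (applyUpTo f N) (suc i) ≡ f i
at-applyUpTo f (suc N) zero _ = refl
at-applyUpTo f (suc N) (suc i) (s≤s i<N) = at-applyUpTo (λ j → f (suc j)) N i i<N

at-map-range1 : ∀ (f : ℕ → ℕ) N i → InRange N i → at (map f (range1 N)) i ≡ f i
at-map-range1 f N (suc i) (_ , i<N) rewrite map-range1 f N = at-applyUpTo (λ j → f (suc j)) N i i<N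

applyUpTo-at : ∀ xs → xs ≡ applyUpTo (λ i → at xs (suc i)) (length xs)
applyUpTo-at [] = refl
applyUpTo-at (x ∷ xs) = cong (x ∷_) (applyUpTo-at xs)

applyUpTo-cong : ∀ {f g : ℕ → ℕ} N → (∀ i → i < N → f i ≡ g i) → applyUpTo f N ≡ applyUpTo g N
applyUpTo-cong zero h = refl
applyUpTo-cong (suc N) h = cong₂ _∷_ (h 0 (s≤s z≤n)) (applyUpTo-cong N (λ i i<N → h (suc i) (s≤s i<N)))

at-ext : ∀ xs N (f : ℕ → ℕ) → length xs ≡ N → (∀ i → InRange N i → at xs i ≡ f i) → xs ≡ map f (range1 N)
at-ext xs N f refl h = begin
  xs                                                 ≡⟨ applyUpTo-at xs ⟩
  applyUpTo (λ i → at xs (suc i)) (length xs)        ≡⟨ applyUpTo-cong (length xs) (λ i i<N → h (suc i) (s≤s z≤n , i<N)) ⟩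
  applyUpTo (λ i → f (suc i)) (length xs)            ≡⟨ map-range1 f (length xs) ⟨
  map f (range1 (length xs))                         ∎
  where open ≡-Reasoning

map-cong-range1 : ∀ N (f g : ℕ → ℕ) → (∀ i → InRange N i → f i ≡ g i) → map f (range1 N) ≡ map g (range1 N)
map-cong-range1 N f g h = at-ext (map f (range1 N)) N g (length-map-range1 f N) (λ i r → trans (at-map-range1 f N i r) (h i r))

at-∈ : ∀ xs i → InRange (length xs) i → at xs i ∈ xs
at-∈ (x ∷ xs) (suc zero) _ = here refl
at-∈ (x ∷ xs) (suc (suc i)) (_ , s≤s h) = there (at-∈ xs (suc i) (s≤s z≤n , h))

∈⇒at : ∀ {xs v} → v ∈ xs → ∃[ i ] (InRange (length xs) i × at xs i ≡ v)
∈⇒at {x ∷ xs} (here refl) = 1 , (s≤s z≤n , s≤s z≤n) , refl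
∈⇒at {x ∷ xs} (there h) with ∈⇒at h
... | suc i , (_ , i≤) , eq = suc (suc i) , (s≤s z≤n , s≤s i≤) , eq

at-0 : ∀ xs → at xs 0 ≡ 0
at-0 [] = refl
at-0 (x ∷ xs) = refl

at-inj : ∀ {xs} → Unique xs → ∀ i j → InRange (length xs) i → InRange (length xs) j → at xs i ≡ at xs j → i ≡ j
at-inj {x ∷ xs} u (suc zero) (suc zero) _ _ _ = refl
at-inj {x ∷ xs} (px ∷ u) (suc zero) (suc (suc j)) _ (_ , s≤s jh) eq =
  ⊥-elim (All.lookup px (at-∈ xs (suc j) (s≤s z≤n , jh)) eq)
at-inj {x ∷ xs} (px ∷ u) (suc (suc i)) (suc zero) (_ , s≤s ih) _ eq =
  ⊥-elim (All.lookup px (at-∈ xs (suc i) (s≤s z≤n , ih)) (sym eq))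
at-inj {x ∷ xs} (px ∷ u) (suc (suc i)) (suc (suc j)) (_ , s≤s ih) (_ , s≤s jh) eq =
  cong suc (at-inj u (suc i) (suc j) (s≤s z≤n , ih) (s≤s z≤n , jh) eq)

at-snoc : ∀ xs a i → i ≤ length xs → at (xs ++ [ a ]) i ≡ at xs i
at-snoc [] a zero _ = refl
at-snoc (x ∷ xs) a zero _ = refl
at-snoc (x ∷ xs) a (suc zero) _ = refl
at-snoc (x ∷ xs) a (suc (suc i)) (s≤s h) = at-snoc xs a (suc i) h

at-snoc-last : ∀ xs a → at (xs ++ [ a ]) (suc (length xs)) ≡ a
at-snoc-last [] a = refl
at-snoc-last (x ∷ xs) a = at-snoc-last xs a

length-snoc : ∀ (xs : List ℕ) a → length (xs ++ [ a ]) ≡ suc (length xs)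
length-snoc xs a = trans (length-++ xs) (+-comm (length xs) 1)

indexOf-∈ : ∀ {v xs} → v ∈ xs → InRange (length xs) (indexOf v xs) × at xs (indexOf v xs) ≡ v
indexOf-∈ {v} {x ∷ xs} h with v ≡ᵇ x in eq
... | true = (s≤s z≤n , s≤s z≤n) , sym (T-≡ᵇ (subst T (sym eq) tt))
... | false with h
...   | here refl = ⊥-elim (subst T eq (≡ᵇ-T {v} refl))
...   | there h' rewrite if-T {x = suc (indexOf v xs)} {y = 0} (∈⇒elemᵇ h') with indexOf-∈ h'
...     | (lo , hi) , a with indexOf v xs
...       | suc k = (s≤s z≤n , s≤s hi) , a

indexOf-at : ∀ {xs} → Unique xs → ∀ i → InRange (length xs) i → indexOf (at xs i) xs ≡ i
indexOf-at {xs} u i r with indexOf-∈ (at-∈ xs i r)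
... | r' , eq = at-inj u _ i r' r eq

at-strictMono : ∀ {xs} → Increasing xs → ∀ i j → 1 ≤ i → i < j → j ≤ length xs → at xs i < at xs j
at-strictMono {x ∷ xs} (px ∷ inc) (suc zero) (suc zero) _ (s≤s ()) _
at-strictMono {x ∷ xs} (px ∷ inc) (suc zero) (suc (suc j)) _ _ (s≤s jh) = All.lookup px (at-∈ xs (suc j) (s≤s z≤n , jh))
at-strictMono {x ∷ xs} (px ∷ inc) (suc (suc i)) (suc (suc j)) _ (s≤s i<j) (s≤s jh) = at-strictMono inc (suc i) (suc j) (s≤s z≤n) i<j jh

at-mono : ∀ {xs} → Increasing xs → ∀ i j → 1 ≤ i → i ≤ j → j ≤ length xs → at xs i ≤ at xs j
at-mono inc i j lo i≤j hi with m≤n⇒m<n∨m≡n i≤j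
... | inj₁ i<j = <⇒≤ (at-strictMono inc i j lo i<j hi)
... | inj₂ refl = ≤-refl

at-reflects-< : ∀ {xs} → Increasing xs → ∀ i j → InRange (length xs) i → InRange (length xs) j → at xs i < at xs j → i < j
at-reflects-< inc i j ri rj lt with <-cmp i j
... | tri< a _ _ = a
... | tri≈ _ refl _ = ⊥-elim (<-irrefl refl lt)
... | tri> _ _ c = ⊥-elim (<-asym lt (at-strictMono inc j i (proj₁ rj) c (proj₂ ri)))

<at-suc⇒≤at : ∀ {L} → Increasing L → ∀ i x → 1 ≤ i → suc i ≤ length L → x ∈ L → x < at L (suc i) → x ≤ at L i
<at-suc⇒≤at {L} inc i x lo hi x∈ lt with ∈⇒at x∈
... | k , rk , refl = at-mono inc k i (proj₁ rk) (≤-pred (at-reflects-< inc k (suc i) rk (s≤s z≤n , hi) lt)) (≤-trans (n≤1+n i) hi)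

<at⇒< : ∀ {L} → Increasing L → ∀ j X → InRange (length L) j → at L (j ∸ 1) < X → ∀ x → x ∈ L → x < at L j → x < X
<at⇒< {L} inc (suc zero) X rj lt x x∈ xl with ∈⇒at x∈
... | k , rk , refl = ⊥-elim (<⇒≱ (at-reflects-< inc k 1 rk rj xl) (proj₁ rk))
<at⇒< {L} inc (suc (suc j)) X rj lt x x∈ xl = ≤-<-trans (<at-suc⇒≤at inc (suc j) x (s≤s z≤n) (proj₂ rj) x∈ xl) lt

Increasing-last : ∀ {L n} → Increasing L → n ∈ L → (∀ x → x ∈ L → x ≤ n) → at L (length L) ≡ n
Increasing-last {L} {n} inc n∈ mx with ∈⇒at n∈
... | i , ri , eq with m≤n⇒m<n∨m≡n (proj₂ ri)
...   | inj₂ refl = eq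
...   | inj₁ i<L = ⊥-elim (<⇒≱ (subst (_< at L (length L)) eq (at-strictMono inc i (length L) (proj₁ ri) i<L ≤-refl))
                                 (mx _ (at-∈ L (length L) (≤-trans (proj₁ ri) (<⇒≤ i<L) , ≤-refl))))

firstGeq-≡ : ∀ {L} → Increasing L → ∀ e y → InRange (length L) y → at L (y ∸ 1) < e → e ≤ at L y → firstGeq e L ≡ y
firstGeq-≡ {x ∷ xs} inc e (suc zero) _ _ le = if-T (≤⇒≤ᵇ le)
firstGeq-≡ {x ∷ xs} (px ∷ inc) e (suc (suc zero)) (_ , s≤s hi) lt le =
  trans (if-¬T (¬≤ᵇ lt)) (trans (if-T (any-≤ᵇ (at-∈ xs 1 (s≤s z≤n , hi)) le))
        (cong suc (firstGeq-≡ inc e 1 (s≤s z≤n , hi) (subst (_< e) (sym (at-0 xs)) (≤-<-trans z≤n lt)) le)))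
  where
  any-≤ᵇ : ∀ {z zs} → z ∈ zs → e ≤ z → T (any (e ≤ᵇ_) zs)
  any-≤ᵇ z∈ e≤z = any⁺ (e ≤ᵇ_) (Any.map (λ { refl → ≤⇒≤ᵇ e≤z }) z∈)
firstGeq-≡ {x ∷ xs} (px ∷ inc) e (suc (suc (suc y))) (_ , s≤s hi) lt le =
  trans (if-¬T (¬≤ᵇ x<e)) (trans (if-T (any-≤ᵇ (at-∈ xs (suc (suc y)) (s≤s z≤n , hi)) le))
        (cong suc (firstGeq-≡ inc e (suc (suc y)) (s≤s z≤n , hi) lt le)))
  where
  x<e : x < e
  x<e = <-trans (All.lookup px (at-∈ xs (suc y) (s≤s z≤n , ≤-trans (n≤1+n _) hi))) lt
  any-≤ᵇ : ∀ {z zs} → z ∈ zs → e ≤ z → T (any (e ≤ᵇ_) zs)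
  any-≤ᵇ z∈ e≤z = any⁺ (e ≤ᵇ_) (Any.map (λ { refl → ≤⇒≤ᵇ e≤z }) z∈)

firstGeq-exists : ∀ {L} → Increasing L → ∀ e v → 1 ≤ e → v ∈ L → e ≤ v →
  ∃[ y ] (InRange (length L) y × at L (y ∸ 1) < e × e ≤ at L y)
firstGeq-exists {x ∷ xs} (px ∷ inc) e v e≥1 v∈ e≤v with e ≤? x
... | yes e≤x = 1 , (s≤s z≤n , s≤s z≤n) , e≥1 , e≤x
... | no e≰x with v∈
...   | here refl = ⊥-elim (e≰x e≤v)
...   | there v∈' with firstGeq-exists inc e v e≥1 v∈' e≤v
...     | suc zero , (_ , hi) , lt , le = 2 , (s≤s z≤n , s≤s hi) , ≰⇒> e≰x , le
...     | suc (suc y) , (_ , hi) , lt , le = suc (suc (suc y)) , (s≤s z≤n , s≤s hi) , lt , le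

firstGeq-spec : ∀ {L} → Increasing L → ∀ e v → 1 ≤ e → v ∈ L → e ≤ v →
  InRange (length L) (firstGeq e L) × at L (firstGeq e L ∸ 1) < e × e ≤ at L (firstGeq e L)
firstGeq-spec inc e v e≥1 v∈ e≤v with firstGeq-exists inc e v e≥1 v∈ e≤v
... | y , ry , lt , le rewrite firstGeq-≡ inc e y ry lt le = ry , lt , le

lastTrue : (ℕ → Bool) → ℕ → ℕ
lastTrue b zero = zero
lastTrue b (suc j) = if b (suc j) then suc j else lastTrue b j
lastTrue-≤ : ∀ b N → lastTrue b N ≤ N
lastTrue-≤ b zero = z≤n
lastTrue-≤ b (suc N) with b (suc N)
... | true = ≤-refl
... | false = ≤-trans (lastTrue-≤ b N) (n≤1+n N)

lastTrue-spec : ∀ b N → 1 ≤ N → T (b 1) → 1 ≤ lastTrue b N × T (b (lastTrue b N)) × (∀ j → lastTrue b N < j → j ≤ N → ¬ T (b j))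
lastTrue-spec b (suc N) _ b1 with b (suc N) in eq
... | true = s≤s z≤n , subst T (sym eq) tt , λ j lt hi → ⊥-elim (<⇒≱ lt hi)
... | false with N
...   | zero = ⊥-elim (subst T eq b1)
...   | suc N' with lastTrue-spec b (suc N') (s≤s z≤n) b1
...     | lo , bt , nb = lo , bt , f
  where
  f : ∀ j → lastTrue b (suc N') < j → j ≤ suc (suc N') → ¬ T (b j)
  f j lt hi with m≤n⇒m<n∨m≡n hi
  ... | inj₁ j<  = nb j lt (≤-pred j<)
  ... | inj₂ refl = λ t → subst T eq t

lastTrue-unique : ∀ b N y → 1 ≤ y → y ≤ N → T (b y) → (∀ j → y < j → j ≤ N → ¬ T (b j)) → lastTrue b N ≡ y
lastTrue-unique b zero (suc y) lo () by nb
lastTrue-unique b (suc N) y lo hi by nb with m≤n⇒m<n∨m≡n hi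
... | inj₂ refl = if-T by
... | inj₁ y< = trans (if-¬T (nb (suc N) y< ≤-refl)) (lastTrue-unique b N y lo (≤-pred y<) by (λ j lt h → nb j lt (≤-trans h (n≤1+n N))))


InRange-suc : ∀ {m r} → InRange m r → InRange (suc m) r
InRange-suc {m} (lo , hi) = lo , ≤-trans hi (n≤1+n m)

InRange-suc⇒≤ : ∀ {m r} → InRange (suc m) r → r ≢ suc m → r ≤ m
InRange-suc⇒≤ rr r≢ = ≤-pred (≤∧≢⇒< (proj₂ rr) r≢)

i∸1<i : ∀ i → 1 ≤ i → i ∸ 1 < i
i∸1<i (suc i) _ = ≤-refl

pred-range : ∀ d i t → 1 ≤ d → d < i → i ≤ suc t → InRange t (i ∸ 1)
pred-range d (suc (suc k)) t _ _ (s≤s hi) = s≤s z≤n , hi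
pred-range (suc d) (suc zero) t _ (s≤s ()) _

InjectiveOn : ℕ → (ℕ → ℕ) → Set
InjectiveOn N f = ∀ i j → InRange N i → InRange N j → f i ≡ f j → i ≡ j

MapsInto : ℕ → (ℕ → ℕ) → Set
MapsInto N f = ∀ i → InRange N i → InRange N (f i)

leftInverse⇒injectiveOn : ∀ N (f g : ℕ → ℕ) → (∀ i → InRange N i → g (f i) ≡ i) → InjectiveOn N f
leftInverse⇒injectiveOn N f g h i j ri rj eq = trans (sym (h i ri)) (trans (cong g eq) (h j rj))

MapsInto-∘ : ∀ N (f g : ℕ → ℕ) → MapsInto N f → MapsInto N g → MapsInto N (g ∘ f)
MapsInto-∘ N f g if ig x r = ig (f x) (if x r)

InjectiveOn-∘ : ∀ N (f g : ℕ → ℕ) → MapsInto N f → InjectiveOn N f → InjectiveOn N g → InjectiveOn N (g ∘ f)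
InjectiveOn-∘ N f g if jf jg x y rx ry eq = jf x y rx ry (jg (f x) (f y) (if x rx) (if y ry) eq)

Unique-resp-↭ : ∀ {xs ys : List ℕ} → xs ↭ ys → Unique xs → Unique ys
Unique-resp-↭ p = PermutationSetoid.Unique-resp-↭ (setoid ℕ) (↭⇒↭ₛ p)

Unique-map⁺ : ∀ (f : ℕ → ℕ) {xs} → Unique xs → (∀ x y → x ∈ xs → y ∈ xs → f x ≡ f y → x ≡ y) → Unique (map f xs)
Unique-map⁺ f {[]} _ _ = []
Unique-map⁺ f {x ∷ xs} (px ∷ u) inj =
  All.tabulate (λ v∈ eq → fx≢ v∈ eq) ∷ Unique-map⁺ f u (λ a b a∈ b∈ e → inj a b (there a∈) (there b∈) e)
  where
  fx≢ : ∀ {v} → v ∈ map f xs → f x ≡ v → ⊥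
  fx≢ v∈ eq with ∈-map⁻ f v∈
  ... | z , z∈ , refl = All.lookup px z∈ (inj x z (here refl) (there z∈) eq)

module PermFacts {N : ℕ} {xs : List ℕ} (p : IsPerm N xs) where
  plen : length xs ≡ N
  plen = trans (↭-length p) (length-range1 N)

  puniq : Unique xs
  puniq = Unique-resp-↭ (↭-sym p) (Increasing⇒Unique (range1-increasing N))

  pmem⁻ : ∀ {v} → v ∈ xs → InRange N v
  pmem⁻ h = ∈-range1⁻ (∈-resp-↭ p h)

  pmem⁺ : ∀ {v} → InRange N v → v ∈ xs
  pmem⁺ r = ∈-resp-↭ (↭-sym p) (∈-range1⁺ r)

  rl : ∀ {i} → InRange N i → InRange (length xs) i
  rl {i} r = subst (λ L → InRange L i) (sym plen) r

  lr : ∀ {i} → InRange (length xs) i → InRange N i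
  lr {i} r = subst (λ L → InRange L i) plen r

  pinto : MapsInto N (at xs)
  pinto i r = pmem⁻ (at-∈ xs i (rl r))

  pinj : InjectiveOn N (at xs)
  pinj i j ri rj eq = at-inj puniq i j (rl ri) (rl rj) eq

  pidx : ∀ {v} → InRange N v → InRange N (indexOf v xs) × at xs (indexOf v xs) ≡ v
  pidx r with indexOf-∈ (pmem⁺ r)
  ... | r' , eq = lr r' , eq

  pindexOf : ∀ i → InRange N i → indexOf (at xs i) xs ≡ i
  pindexOf i r = indexOf-at puniq i (rl r)

  NE : List ℕ
  NE = nonExcPos xs
  E : List ℕ
  E = excPos xs

  NE≡ : NE ≡ filterᵇ (λ i → not (i <ᵇ at xs i)) (range1 N)
  NE≡ = cong (λ L → filterᵇ (λ i → not (i <ᵇ at xs i)) (range1 L)) plen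

  E≡ : E ≡ filterᵇ (λ i → i <ᵇ at xs i) (range1 N)
  E≡ = cong (λ L → filterᵇ (λ i → i <ᵇ at xs i) (range1 L)) plen

  ∈NE⁻ : ∀ {r} → r ∈ NE → InRange N r × at xs r ≤ r
  ∈NE⁻ {r} h with rr , t ← ∈-filterR⁻ {λ i → not (i <ᵇ at xs i)} (subst (r ∈_) NE≡ h) = rr , ≮⇒≥ (T-not t ∘ <⇒<ᵇ)

  ∈NE⁺ : ∀ {r} → InRange N r → at xs r ≤ r → r ∈ NE
  ∈NE⁺ {r} rr le = subst (r ∈_) (sym NE≡) (∈-filterR⁺ {λ i → not (i <ᵇ at xs i)} rr (not-T (¬<ᵇ le)))

  ∈E⁻ : ∀ {r} → r ∈ E → InRange N r × r < at xs r
  ∈E⁻ {r} h with rr , t ← ∈-filterR⁻ {λ i → i <ᵇ at xs i} (subst (r ∈_) E≡ h) = rr , T-<ᵇ t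

  ∈E⁺ : ∀ {r} → InRange N r → r < at xs r → r ∈ E
  ∈E⁺ {r} rr lt = subst (r ∈_) (sym E≡) (∈-filterR⁺ {λ i → i <ᵇ at xs i} rr (<⇒<ᵇ lt))

  IncNE : Increasing NE
  IncNE = subst Increasing (sym NE≡) (Increasing-filterR _ N)

  IncE : Increasing E
  IncE = subst Increasing (sym E≡) (Increasing-filterR _ N)

Unique-map-range1 : ∀ N (f : ℕ → ℕ) → InjectiveOn N f → Unique (map f (range1 N))
Unique-map-range1 N f inj rewrite map-range1 f N =
  applyUpTo⁺₁ (λ i → f (suc i)) N
    (λ {i} {j} i<j j<N eq → <⇒≢ (s≤s i<j) (inj (suc i) (suc j) (s≤s z≤n , ≤-trans (s≤s (<⇒≤ i<j)) j<N) (s≤s z≤n , j<N) eq))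

⊆⇒length≤ : ∀ {xs ys : List ℕ} → Unique xs → (∀ v → v ∈ xs → v ∈ ys) → length xs ≤ length ys
⊆⇒length≤ {[]} _ _ = z≤n
⊆⇒length≤ {x ∷ xs} {ys} (px ∷ u) h with ∈-∃++ (h x (here refl))
... | as , bs , refl = ≤-trans (s≤s (⊆⇒length≤ u sub)) (≤-reflexive eqL)
  where
  sub : ∀ v → v ∈ xs → v ∈ as ++ bs
  sub v v∈ with ∈-++⁻ as (h v (there v∈))
  ... | inj₁ q = ∈-++⁺ˡ q
  ... | inj₂ (here refl) = ⊥-elim (All.lookup px v∈ refl)
  ... | inj₂ (there q) = ∈-++⁺ʳ as q
  eqL : suc (length (as ++ bs)) ≡ length (as ++ [ x ] ++ bs)
  eqL = trans (cong suc (length-++ as)) (trans (sym (+-suc (length as) (length bs))) (sym (length-++ as)))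

⊆∧length≥⇒⊇ : ∀ {xs ys : List ℕ} → Unique xs → (∀ v → v ∈ xs → v ∈ ys) → length ys ≤ length xs →
              ∀ v → v ∈ ys → v ∈ xs
⊆∧length≥⇒⊇ {xs} {ys} u sub le v v∈ with v ∈? xs
... | yes q = q
... | no v∉ = ⊥-elim (<⇒≱ (⊆⇒length≤ u' sub') le)
  where
  u' : Unique (v ∷ xs)
  u' = All.tabulate (λ {y} y∈ eq → v∉ (subst (_∈ xs) (sym eq) y∈)) ∷ u
  sub' : ∀ y → y ∈ v ∷ xs → y ∈ ys
  sub' y (here refl) = v∈
  sub' y (there q) = sub y q

map-range1-isPerm : ∀ N (f : ℕ → ℕ) → MapsInto N f → InjectiveOn N f → IsPerm N (map f (range1 N))
map-range1-isPerm N f into inj = ∼bag⇒↭ (unique∧set⇒bag U1 U2 (mk⇔ to from))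
  where
  U1 : Unique (map f (range1 N))
  U1 = Unique-map-range1 N f inj
  U2 : Unique (range1 N)
  U2 = Increasing⇒Unique (range1-increasing N)
  to : ∀ {v} → v ∈ map f (range1 N) → v ∈ range1 N
  to h with ∈-map⁻ f h
  ... | i , i∈ , refl = ∈-range1⁺ (into i (∈-range1⁻ i∈))
  from : ∀ {v} → v ∈ range1 N → v ∈ map f (range1 N)
  from {v} h = ⊆∧length≥⇒⊇ U1 (λ _ → to) (≤-reflexive (trans (length-range1 N) (sym (length-map-range1 f N)))) v h

IsPerm-restrict : ∀ m (G : ℕ → ℕ) → MapsInto (suc m) G → InjectiveOn (suc m) G → G (suc m) ≡ suc m →
                  IsPerm m (map G (range1 m))
IsPerm-restrict m G into inj Gn = map-range1-isPerm m G into' inj'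
  where
  into' : MapsInto m G
  into' i r with m≤n⇒m<n∨m≡n (proj₂ (into i (InRange-suc r)))
  ... | inj₁ lt = proj₁ (into i (InRange-suc r)) , ≤-pred lt
  ... | inj₂ eq = ⊥-elim (<-irrefl (inj i (suc m) (InRange-suc r) (s≤s z≤n , ≤-refl) (trans eq (sym Gn))) (s≤s (proj₂ r)))
  inj' : InjectiveOn m G
  inj' i j ri rj eq = inj i j (InRange-suc ri) (InRange-suc rj) eq

IsPerm-∷ʳ : ∀ m σ → IsPerm m σ → IsPerm (suc m) (σ ++ [ suc m ])
IsPerm-∷ʳ m σ p = subst (λ L → σ ++ [ suc m ] ↭ L) (sym (range1-snoc m)) (++⁺ʳ [ suc m ] p)

-- The value cycle

prevIn : ℕ → List ℕ → ℕ → ℕ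
prevIn b [] v = v
prevIn b (a ∷ as) v = if v ≡ᵇ a then b else prevIn a as v
nextIn-∉ : ∀ n L v → v ∉ L → nextIn n L v ≡ v
nextIn-∉ n [] v _ = refl
nextIn-∉ n (a ∷ []) v h = if-¬T (λ t → h (here (T-≡ᵇ t)))
nextIn-∉ n (a ∷ b ∷ cs) v h = trans (if-¬T (λ t → h (here (T-≡ᵇ t)))) (nextIn-∉ n (b ∷ cs) v (λ q → h (there q)))

prevIn-∉ : ∀ b L u → u ∉ L → prevIn b L u ≡ u
prevIn-∉ b [] u _ = refl
prevIn-∉ b (a ∷ as) u h = trans (if-¬T (λ t → h (here (T-≡ᵇ t)))) (prevIn-∉ a as u (λ q → h (there q)))

nextIn-∈ : ∀ n e rest v → v ∈ e ∷ rest → nextIn n (e ∷ rest) v ∈ rest ++ [ n ]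
nextIn-∈ n e [] v h with v ≡ᵇ e in eq
... | true = here refl
... | false with h
...   | here refl = ⊥-elim (subst T eq (≡ᵇ-T {v} refl))
nextIn-∈ n e (a ∷ r) v h with v ≡ᵇ e in eq
... | true = here refl
... | false with h
...   | here refl = ⊥-elim (subst T eq (≡ᵇ-T {v} refl))
...   | there q = there (nextIn-∈ n a r v q)

prevIn-∈ : ∀ n e rest u → u ∈ rest ++ [ n ] → prevIn e (rest ++ [ n ]) u ∈ e ∷ rest
prevIn-∈ n e [] u h with u ≡ᵇ n in eq
... | true = here refl
... | false with h
...   | here refl = ⊥-elim (subst T eq (≡ᵇ-T {u} refl))
prevIn-∈ n e (a ∷ r) u h with u ≡ᵇ a in eq
... | true = here refl
... | false with h
...   | here refl = ⊥-elim (subst T eq (≡ᵇ-T {u} refl))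
...   | there q = there (prevIn-∈ n a r u q)

prevIn-nextIn : ∀ n e rest v → Increasing (e ∷ rest ++ [ n ]) → v ∈ e ∷ rest → prevIn e (rest ++ [ n ]) (nextIn n (e ∷ rest) v) ≡ v
prevIn-nextIn n e [] v I h with h
... | here refl = trans (cong (prevIn e [ n ]) (if-T (≡ᵇ-T {v} refl))) (if-T (≡ᵇ-T {n} refl))
prevIn-nextIn n e (a ∷ r) v (pe ∷ I) h with v ≡ᵇ e in eq
... | true = trans (if-T (≡ᵇ-T {a} refl)) (sym (T-≡ᵇ (subst T (sym eq) tt)))
... | false with h
...   | here refl = ⊥-elim (subst T eq (≡ᵇ-T {v} refl))
...   | there q = trans (if-¬T ne) (prevIn-nextIn n a r v I q)
  where
  u∈ = nextIn-∈ n a r v q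
  ne : ¬ T (nextIn n (a ∷ r) v ≡ᵇ a)
  ne t = <-irrefl (sym (T-≡ᵇ t)) (All.lookup (AP.head I) u∈)

nextIn-prevIn : ∀ n e rest u → Increasing (e ∷ rest ++ [ n ]) → u ∈ rest ++ [ n ] → nextIn n (e ∷ rest) (prevIn e (rest ++ [ n ]) u) ≡ u
nextIn-prevIn n e [] u I h with h
... | here refl = trans (cong (nextIn n [ e ]) (if-T (≡ᵇ-T {u} refl))) (if-T (≡ᵇ-T {e} refl))
nextIn-prevIn n e (a ∷ r) u (pe ∷ I) h with u ≡ᵇ a in eq
... | true = trans (if-T (≡ᵇ-T {e} refl)) (sym (T-≡ᵇ (subst T (sym eq) tt)))
... | false with h
...   | here refl = ⊥-elim (subst T eq (≡ᵇ-T {u} refl))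
...   | there q = trans (if-¬T ne) (nextIn-prevIn n a r u I q)
  where
  x∈ = prevIn-∈ n a r u q
  ne : ¬ T (prevIn a (r ++ [ n ]) u ≡ᵇ e)
  ne t with x∈
  ... | here eqa = <-irrefl (trans (sym (T-≡ᵇ t)) eqa) (All.lookup pe (here refl))
  ... | there q' = <-irrefl (sym (T-≡ᵇ t)) (All.lookup pe (there (∈-++⁺ˡ q')))

nextIn-> : ∀ n e rest v → Increasing (e ∷ rest ++ [ n ]) → v ∈ e ∷ rest → v < nextIn n (e ∷ rest) v
nextIn-> n e [] v (pe ∷ _) h with h
... | here refl = subst (v <_) (sym (if-T (≡ᵇ-T {v} refl))) (All.lookup pe (here refl))
nextIn-> n e (a ∷ r) v (pe ∷ I) h with v ≡ᵇ e in eq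
... | true = subst (_< a) (sym (T-≡ᵇ (subst T (sym eq) tt))) (All.lookup pe (here refl))
... | false with h
...   | here refl = ⊥-elim (subst T eq (≡ᵇ-T {v} refl))
...   | there q = nextIn-> n a r v I q

-- For the chain C = e < c₂ < ⋯ < c_x (all below n), cycle n e C is the cyclic permutation
-- (n e c₂ ⋯ c_x): it is Step 1 of the definition, extended by n ↦ e.
cycle : ℕ → ℕ → List ℕ → ℕ → ℕ
cycle n e C v = if v ≡ᵇ n then e else nextIn n C v

cycle⁻¹ : ℕ → ℕ → List ℕ → ℕ → ℕ
cycle⁻¹ n e D u = if u ≡ᵇ e then n else prevIn e D u

module ChainCycle (n e : ℕ) (rest : List ℕ) (I : Increasing (e ∷ rest ++ [ n ])) where
  C : List ℕ
  C = e ∷ rest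
  D : List ℕ
  D = rest ++ [ n ]

  e<D : ∀ {u} → u ∈ D → e < u
  e<D h = All.lookup (AP.head I) h

  rest<n : ∀ {v} → v ∈ rest → v < n
  rest<n h = Increasing-∷ʳ⇒< (AP.tail I) h

  C<n : ∀ {v} → v ∈ C → v < n
  C<n (here refl) = e<D (∈-snoc-last rest n)
  C<n (there h) = rest<n h

  e≤C : ∀ {v} → v ∈ C → e ≤ v
  e≤C (here refl) = ≤-refl
  e≤C (there h) = <⇒≤ (e<D (∈-++⁺ˡ h))

  n∉C : n ∉ C
  n∉C h = <-irrefl refl (C<n h)

  e∉D : e ∉ D
  e∉D h = <-irrefl refl (e<D h)

  cycle⁻¹∘cycle : ∀ v → cycle⁻¹ n e D (cycle n e C v) ≡ v
  cycle⁻¹∘cycle v with v ≡ᵇ n in eq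
  ... | true = trans (if-T (≡ᵇ-T {e} refl)) (sym (T-≡ᵇ (subst T (sym eq) tt)))
  ... | false with v ∈? C
  ...   | yes v∈ = trans (if-¬T (λ t → e∉D (subst (_∈ D) (T-≡ᵇ t) (nextIn-∈ n e rest v v∈)))) (prevIn-nextIn n e rest v I v∈)
  ...   | no v∉ = trans (cong (cycle⁻¹ n e D) (nextIn-∉ n C v v∉)) (trans (if-¬T ne) (prevIn-∉ e D v v∉D))
    where
    ne : ¬ T (v ≡ᵇ e)
    ne t = v∉ (here (T-≡ᵇ t))
    v∉D : v ∉ D
    v∉D h with ∈-snoc⁻ {rest} h
    ... | inj₁ q = v∉ (there q)
    ... | inj₂ refl = subst T eq (≡ᵇ-T {v} refl)

  cycle∘cycle⁻¹ : ∀ u → cycle n e C (cycle⁻¹ n e D u) ≡ u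
  cycle∘cycle⁻¹ u with u ≡ᵇ e in eq
  ... | true = trans (if-T (≡ᵇ-T {n} refl)) (sym (T-≡ᵇ (subst T (sym eq) tt)))
  ... | false with u ∈? D
  ...   | yes u∈ = trans (if-¬T (λ t → n∉C (subst (_∈ C) (T-≡ᵇ t) (prevIn-∈ n e rest u u∈)))) (nextIn-prevIn n e rest u I u∈)
  ...   | no u∉ = trans (cong (cycle n e C) (prevIn-∉ e D u u∉)) (trans (if-¬T ne) (nextIn-∉ n C u u∉C))
    where
    ne : ¬ T (u ≡ᵇ n)
    ne t = u∉ (subst (_∈ D) (sym (T-≡ᵇ t)) (∈-snoc-last rest n))
    u∉C : u ∉ C
    u∉C (here refl) = subst T eq (≡ᵇ-T {u} refl)
    u∉C (there q) = u∉ (∈-++⁺ˡ q)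

  ≤-cycle : ∀ v → v < n → v ≤ cycle n e C v
  ≤-cycle v v<n with v ∈? C
  ... | yes v∈ = subst (v ≤_) (sym (if-¬T (¬≡ᵇ (<⇒≢ v<n)))) (<⇒≤ (nextIn-> n e rest v I v∈))
  ... | no v∉ = ≤-reflexive (sym (trans (if-¬T (¬≡ᵇ (<⇒≢ v<n))) (nextIn-∉ n C v v∉)))

  cycle-into : ∀ v → InRange n v → 1 ≤ e → InRange n (cycle n e C v)
  cycle-into v (lo , hi) e≥1 with v ≡ᵇ n
  ... | true = e≥1 , <⇒≤ (C<n (here refl))
  ... | false with v ∈? C
  ...   | yes v∈ with ∈-snoc⁻ {rest} (nextIn-∈ n e rest v v∈)
  ...     | inj₁ q = ≤-trans lo (<⇒≤ (nextIn-> n e rest v I v∈)) , <⇒≤ (rest<n q)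
  ...     | inj₂ eqn = ≤-trans lo (<⇒≤ (nextIn-> n e rest v I v∈)) , ≤-reflexive eqn
  cycle-into v (lo , hi) e≥1 | false | no v∉ rewrite nextIn-∉ n C v v∉ = lo , hi

  cycle⁻¹-into : ∀ u → InRange n u → 1 ≤ e → InRange n (cycle⁻¹ n e D u)
  cycle⁻¹-into u (lo , hi) e≥1 with u ≡ᵇ e
  ... | true = ≤-trans e≥1 (<⇒≤ (C<n (here refl))) , ≤-refl
  ... | false with u ∈? D
  ...   | yes u∈ = ≤-trans e≥1 (e≤C (prevIn-∈ n e rest u u∈)) , <⇒≤ (C<n (prevIn-∈ n e rest u u∈))
  ...   | no u∉ rewrite prevIn-∉ e D u u∉ = lo , hi

-- The position slide

-- For K = k₁ < ⋯ < k_L with k_L = n, slide K j n sends k_i to k_{i-1} for i > j and k_j to n, fixing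
-- everything else; reading a one-line word through it performs Steps 2 and 3 of the definition.
slide : List ℕ → ℕ → ℕ → ℕ → ℕ
slide K j n r =
  if elemᵇ r K then (if j <ᵇ indexOf r K then at K (indexOf r K ∸ 1) else (if indexOf r K ≡ᵇ j then n else r)) else r

slide⁻¹ : List ℕ → ℕ → ℕ → ℕ
slide⁻¹ K j r =
  if elemᵇ r K then (if indexOf r K ≡ᵇ length K then at K j else (if j ≤ᵇ indexOf r K then at K (suc (indexOf r K)) else r)) else r

module Slide (K : List ℕ) (n j : ℕ) (inc : Increasing K) (L≥1 : 1 ≤ length K)
             (last : at K (length K) ≡ n) (rj : InRange (length K) j) where
  L : ℕ
  L = length K

  idx : ∀ i → InRange L i → indexOf (at K i) K ≡ i
  idx i r = indexOf-at (Increasing⇒Unique inc) i r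

  slide-at : ∀ i → InRange L i →
             slide K j n (at K i) ≡ (if j <ᵇ i then at K (i ∸ 1) else (if i ≡ᵇ j then n else at K i))
  slide-at i r = trans (if-T (∈⇒elemᵇ (at-∈ K i r)))
                       (cong (λ k → if j <ᵇ k then at K (k ∸ 1) else (if k ≡ᵇ j then n else at K i)) (idx i r))

  slide⁻¹-at : ∀ i → InRange L i →
               slide⁻¹ K j (at K i) ≡ (if i ≡ᵇ L then at K j else (if j ≤ᵇ i then at K (suc i) else at K i))
  slide⁻¹-at i r = trans (if-T (∈⇒elemᵇ (at-∈ K i r)))
                         (cong (λ k → if k ≡ᵇ L then at K j else (if j ≤ᵇ k then at K (suc k) else at K i)) (idx i r))

  slide-> : ∀ i → InRange L i → j < i → slide K j n (at K i) ≡ at K (i ∸ 1)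
  slide-> i r j<i = trans (slide-at i r) (if-T (<⇒<ᵇ j<i))

  slide-≡ : slide K j n (at K j) ≡ n
  slide-≡ = trans (slide-at j rj) (trans (if-¬T (¬<ᵇ {j} ≤-refl)) (if-T (≡ᵇ-T {j} refl)))

  slide-< : ∀ i → InRange L i → i < j → slide K j n (at K i) ≡ at K i
  slide-< i r i<j = trans (slide-at i r) (trans (if-¬T (¬<ᵇ (<⇒≤ i<j))) (if-¬T (¬≡ᵇ (<⇒≢ i<j))))

  slide-∉ : ∀ r → r ∉ K → slide K j n r ≡ r
  slide-∉ r h = if-¬T (∉⇒¬elemᵇ h)

  slide-last-id : L ≡ j → ∀ r → slide K j n r ≡ r
  slide-last-id L≡j r with r ∈? K
  ... | no r∉ = slide-∉ r r∉
  ... | yes r∈ with ∈⇒at r∈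
  ...   | i , ri , refl with m≤n⇒m<n∨m≡n (proj₂ ri)
  ...     | inj₁ i<L = slide-< i ri (subst (i <_) L≡j i<L)
  ...     | inj₂ refl = trans (cong (slide K j n ∘ at K) L≡j) (trans slide-≡ (sym last))

  slide⁻¹-last : slide⁻¹ K j (at K L) ≡ at K j
  slide⁻¹-last = trans (slide⁻¹-at L (L≥1 , ≤-refl)) (if-T (≡ᵇ-T {L} refl))

  slide⁻¹-≥ : ∀ i → InRange L i → j ≤ i → i < L → slide⁻¹ K j (at K i) ≡ at K (suc i)
  slide⁻¹-≥ i r j≤i i<L = trans (slide⁻¹-at i r) (trans (if-¬T (¬≡ᵇ (<⇒≢ i<L))) (if-T (≤⇒≤ᵇ j≤i)))

  slide⁻¹-< : ∀ i → InRange L i → i < j → slide⁻¹ K j (at K i) ≡ at K i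
  slide⁻¹-< i r i<j =
    trans (slide⁻¹-at i r) (trans (if-¬T (¬≡ᵇ (<⇒≢ (<-≤-trans i<j (proj₂ rj))))) (if-¬T (¬≤ᵇ i<j)))

  slide⁻¹-∉ : ∀ r → r ∉ K → slide⁻¹ K j r ≡ r
  slide⁻¹-∉ r h = if-¬T (∉⇒¬elemᵇ h)

  slide⁻¹∘slide-> : ∀ i → InRange L i → j < i → slide⁻¹ K j (slide K j n (at K i)) ≡ at K i
  slide⁻¹∘slide-> (suc i') ri j<i = trans (cong (slide⁻¹ K j) (slide-> (suc i') ri j<i))
    (slide⁻¹-≥ i' (≤-trans (proj₁ rj) (≤-pred j<i) , ≤-trans (n≤1+n i') (proj₂ ri)) (≤-pred j<i) (proj₂ ri))

  slide⁻¹∘slide : ∀ r → slide⁻¹ K j (slide K j n r) ≡ r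
  slide⁻¹∘slide r with r ∈? K
  ... | no r∉ = trans (cong (slide⁻¹ K j) (slide-∉ r r∉)) (slide⁻¹-∉ r r∉)
  ... | yes r∈ with ∈⇒at r∈
  ...   | i , ri , refl with <-cmp j i
  ...     | tri< j<i _ _ = slide⁻¹∘slide-> i ri j<i
  ...     | tri≈ _ refl _ = trans (cong (slide⁻¹ K j) (trans slide-≡ (sym last))) slide⁻¹-last
  ...     | tri> _ _ i<j = trans (cong (slide⁻¹ K j) (slide-< i ri i<j)) (slide⁻¹-< i ri i<j)

  slide∘slide⁻¹ : ∀ r → slide K j n (slide⁻¹ K j r) ≡ r
  slide∘slide⁻¹ r with r ∈? K
  ... | no r∉ = trans (cong (slide K j n) (slide⁻¹-∉ r r∉)) (slide-∉ r r∉)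
  ... | yes r∈ with ∈⇒at r∈
  ...   | i , ri , refl with m≤n⇒m<n∨m≡n (proj₂ ri)
  ...     | inj₂ refl = trans (cong (slide K j n) slide⁻¹-last) (trans slide-≡ (sym last))
  ...     | inj₁ i<L with j ≤? i
  ...       | yes j≤i = trans (cong (slide K j n) (slide⁻¹-≥ i ri j≤i i<L)) (slide-> (suc i) (s≤s z≤n , i<L) (s≤s j≤i))
  ...       | no j≰i = trans (cong (slide K j n) (slide⁻¹-< i ri (≰⇒> j≰i))) (slide-< i ri (≰⇒> j≰i))

  slide-into : (∀ x → x ∈ K → InRange n x) → MapsInto n (slide K j n)
  slide-into Kin r rr with r ∈? K
  ... | no r∉ = subst (InRange n) (sym (slide-∉ r r∉)) rr
  ... | yes r∈ with ∈⇒at r∈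
  ...   | i , ri , refl with <-cmp j i
  ...     | tri< j<i _ _ = subst (InRange n) (sym (slide-> i ri j<i)) (Kin _ (at-∈ K (i ∸ 1) (pred-in i ri j<i)))
    where
    pred-in : ∀ i → InRange L i → j < i → InRange L (i ∸ 1)
    pred-in (suc i') ri j<i = ≤-trans (proj₁ rj) (≤-pred j<i) , ≤-trans (n≤1+n i') (proj₂ ri)
  ...     | tri≈ _ refl _ = subst (InRange n) (sym slide-≡) (Kin n (subst (_∈ K) last (at-∈ K L (L≥1 , ≤-refl))))
  ...     | tri> _ _ i<j = subst (InRange n) (sym (slide-< i ri i<j)) rr

  slide⁻¹-into : (∀ x → x ∈ K → InRange n x) → MapsInto n (slide⁻¹ K j)
  slide⁻¹-into Kin r rr with r ∈? K
  ... | no r∉ = subst (InRange n) (sym (slide⁻¹-∉ r r∉)) rr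
  ... | yes r∈ with ∈⇒at r∈
  ...   | i , ri , refl with m≤n⇒m<n∨m≡n (proj₂ ri)
  ...     | inj₂ refl = subst (InRange n) (sym slide⁻¹-last) (Kin _ (at-∈ K j rj))
  ...     | inj₁ i<L with j ≤? i
  ...       | yes j≤i = subst (InRange n) (sym (slide⁻¹-≥ i ri j≤i i<L)) (Kin _ (at-∈ K (suc i) (s≤s z≤n , i<L)))
  ...       | no j≰i = subst (InRange n) (sym (slide⁻¹-< i ri (≰⇒> j≰i))) rr

  slide-inj : InjectiveOn n (slide K j n)
  slide-inj = leftInverse⇒injectiveOn n (slide K j n) (slide⁻¹ K j) (λ i _ → slide⁻¹∘slide i)

  slide⁻¹-inj : InjectiveOn n (slide⁻¹ K j)
  slide⁻¹-inj = leftInverse⇒injectiveOn n (slide⁻¹ K j) (slide K j n) (λ i _ → slide∘slide⁻¹ i)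

-- The decomposition of φ

-- Kof, chainOf, edOf, phiA-entry and phiB-entry are the where-bound K, chain, ed, wA and wB of phiDen,
-- restated at top level so that they can be referred to.
Kof : ℕ → List ℕ → List ℕ
Kof n σ = nonExcPos σ ++ (n ∷ [])

chainOf : List ℕ → ℕ → List ℕ
chainOf σ ed = filterᵇ (λ v → elemᵇ v (map (at σ) (filterᵇ (λ i → (i <ᵇ ed) ∧ (ed ≤ᵇ at σ i)) (excPos σ))))
                  (range1 (length σ))

edOf : List ℕ → ℕ → ℕ
edOf σ c = at (excLetters σ) (suc (exc σ) ∸ c)

phiA-entry : ℕ → List ℕ → ℕ → ℕ → ℕ
phiA-entry n σ c p = if elemᵇ p (Kof n σ)
           then (if firstGeq (edOf σ c) (Kof n σ) <ᵇ indexOf p (Kof n σ) then at σ (at (Kof n σ) (indexOf p (Kof n σ) ∸ 1))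
                 else if indexOf p (Kof n σ) ≡ᵇ firstGeq (edOf σ c) (Kof n σ) then edOf σ c
                 else at σ p)
           else (if elemᵇ (at σ p) (chainOf σ (edOf σ c)) then nextIn n (chainOf σ (edOf σ c)) (at σ p) else at σ p)

phiB-entry : ℕ → List ℕ → ℕ → ℕ → ℕ
phiB-entry n σ d p = if elemᵇ p (Kof n σ)
           then (if d <ᵇ indexOf p (Kof n σ) then at σ (at (Kof n σ) (indexOf p (Kof n σ) ∸ 1))
                 else if indexOf p (Kof n σ) ≡ᵇ d then n
                 else at σ p)
           else at σ p

phiDen-suc : ∀ n σ c → phiDen n σ (suc c) ≡
  (if suc c ≤ᵇ exc σ then map (phiA-entry n σ (suc c)) (range1 n) else map (phiB-entry n σ (suc c ∸ exc σ)) (range1 n))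
phiDen-suc n σ c = refl

module Excedances (m : ℕ) (σ : List ℕ) (pσ : IsPerm m σ) where
  open PermFacts pσ public
  n : ℕ
  n = suc m
  S : ℕ → ℕ
  S = at σ
  EL : List ℕ
  EL = excLetters σ
  K : List ℕ
  K = Kof n σ
  s : ℕ
  s = exc σ
  t : ℕ
  t = length NE

  IncK : Increasing K
  IncK = Increasing-∷ʳ n IncNE (λ v v∈ → s≤s (proj₂ (proj₁ (∈NE⁻ v∈))))

  ∈K⁻ : ∀ {r} → r ∈ K → r ∈ NE ⊎ r ≡ n
  ∈K⁻ h = ∈-snoc⁻ {NE} h

  NE⊆K : ∀ {v} → v ∈ NE → v ∈ K
  NE⊆K = ∈-++⁺ˡ

  n∈K : n ∈ K
  n∈K = ∈-snoc-last NE n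

  lenK : length K ≡ suc t
  lenK = length-snoc NE n

  lastK : at K (suc t) ≡ n
  lastK = at-snoc-last NE n

  lastK' : at K (length K) ≡ n
  lastK' = trans (cong (at K) lenK) lastK

  K-InR : ∀ x → x ∈ K → InRange n x
  K-InR x h with ∈K⁻ h
  ... | inj₁ q = proj₁ (proj₁ (∈NE⁻ q)) , ≤-trans (proj₂ (proj₁ (∈NE⁻ q))) (n≤1+n m)
  ... | inj₂ refl = s≤s z≤n , ≤-refl

  atK-NE : ∀ i → InRange t i → at K i ∈ NE
  atK-NE i r = subst (_∈ NE) (sym (at-snoc NE n i (proj₂ r))) (at-∈ NE i r)

  rK : ∀ {i} → InRange (suc t) i → InRange (length K) i
  rK {i} r = subst (λ L → InRange L i) (sym lenK) r

  Kr : ∀ {i} → InRange (length K) i → InRange (suc t) i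
  Kr {i} r = subst (λ L → InRange L i) lenK r

  idxK : ∀ i → InRange (suc t) i → indexOf (at K i) K ≡ i
  idxK i r = indexOf-at (Increasing⇒Unique IncK) i (rK r)

  idxK-spec : ∀ {r} → r ∈ K → InRange (suc t) (indexOf r K) × at K (indexOf r K) ≡ r
  idxK-spec h with indexOf-∈ h
  ... | rr , eq = Kr rr , eq

  idx-n : indexOf n K ≡ suc t
  idx-n = trans (cong (λ x → indexOf x K) (sym lastK)) (idxK (suc t) (s≤s z≤n , ≤-refl))

  st : s + t ≡ m
  st = trans (cong₂ _+_ (cong length E≡) (cong length NE≡)) (trans (length-filter-split (λ i → i <ᵇ S i) (range1 m)) (length-range1 m))

  Shat : ℕ → ℕ
  Shat = at (σ ++ [ n ])

  Shat-lo : ∀ r → r ≤ m → Shat r ≡ S r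
  Shat-lo r le = at-snoc σ n r (subst (r ≤_) (sym plen) le)

  Shat-n : Shat n ≡ n
  Shat-n = subst (λ L → at (σ ++ [ n ]) (suc L) ≡ n) plen (at-snoc-last σ n)

  pShat : IsPerm n (σ ++ [ n ])
  pShat = IsPerm-∷ʳ m σ pσ

  module PS = PermFacts pShat

  S-NE≢S-E : ∀ {k i} → k ∈ NE → i ∈ E → S k ≢ S i
  S-NE≢S-E {k} {i} k∈ i∈ eq with pinj k i (proj₁ (∈NE⁻ k∈)) (proj₁ (∈E⁻ i∈)) eq
  ... | refl = <⇒≱ (proj₂ (∈E⁻ i∈)) (proj₂ (∈NE⁻ k∈))

  EL≡ : EL ≡ filterᵇ (λ v → elemᵇ v (map S E)) (range1 m)
  EL≡ = cong (λ L → filterᵇ (λ v → elemᵇ v (map S E)) (range1 L)) plen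

  ∈EL⁻ : ∀ {v} → v ∈ EL → InRange m v × ∃[ i ] (i ∈ E × S i ≡ v)
  ∈EL⁻ {v} h with ∈-filterR⁻ {λ v → elemᵇ v (map S E)} {m} (subst (v ∈_) EL≡ h)
  ... | rr , tt' with ∈-map⁻ S (elemᵇ⇒∈ tt')
  ...   | i , i∈ , eq = rr , i , i∈ , sym eq

  ∈EL⁺ : ∀ {v i} → i ∈ E → S i ≡ v → v ∈ EL
  ∈EL⁺ {v} {i} i∈ eq = subst (v ∈_) (sym EL≡) (∈-filterR⁺ {λ v → elemᵇ v (map S E)} rr (∈⇒elemᵇ (subst (_∈ map S E) eq (∈-map⁺ S i∈))))
    where
    rr : InRange m v
    rr = subst (InRange m) eq (pinto i (proj₁ (∈E⁻ i∈)))

  IncEL : Increasing EL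
  IncEL = subst Increasing (sym EL≡) (Increasing-filterR _ m)

  lenEL : length EL ≡ s
  lenEL = trans (↭-length (∼bag⇒↭ (unique∧set⇒bag (Increasing⇒Unique IncEL) UM (mk⇔ to from)))) (length-map S E)
    where
    UM : Unique (map S E)
    UM = Unique-map⁺ S (Increasing⇒Unique IncE) (λ a b a∈ b∈ eq → pinj a b (proj₁ (∈E⁻ a∈)) (proj₁ (∈E⁻ b∈)) eq)
    to : ∀ {v} → v ∈ EL → v ∈ map S E
    to h with ∈EL⁻ h
    ... | _ , i , i∈ , refl = ∈-map⁺ S i∈
    from : ∀ {v} → v ∈ map S E → v ∈ EL
    from h with ∈-map⁻ S h
    ... | i , i∈ , refl = ∈EL⁺ i∈ refl

  chain : ℕ → List ℕ
  chain e = chainOf σ e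

  chain≡ : ∀ e → chain e ≡ filterᵇ (λ v → elemᵇ v (map S (filterᵇ (λ i → (i <ᵇ e) ∧ (e ≤ᵇ S i)) E))) (range1 m)
  chain≡ e = cong (λ L → filterᵇ (λ v → elemᵇ v (map S (filterᵇ (λ i → (i <ᵇ e) ∧ (e ≤ᵇ S i)) E))) (range1 L)) plen

  ∈chain⁻ : ∀ {e v} → v ∈ chain e → InRange m v × ∃[ i ] (i ∈ E × i < e × e ≤ S i × S i ≡ v)
  ∈chain⁻ {e} {v} h with ∈-filterR⁻ {λ v → elemᵇ v (map S (filterᵇ (λ i → (i <ᵇ e) ∧ (e ≤ᵇ S i)) E))} {m} (subst (v ∈_) (chain≡ e) h)
  ... | rr , tt' with ∈-map⁻ S (elemᵇ⇒∈ tt')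
  ...   | i , i∈ , eq with ∈-filter⁻ (T? ∘ λ i → (i <ᵇ e) ∧ (e ≤ᵇ S i)) i∈
  ...     | i∈E , cond = rr , i , i∈E , T-<ᵇ (proj₁ (T-∧ cond)) , T-≤ᵇ (proj₂ (T-∧ {i <ᵇ e} cond)) , sym eq

  ∈chain⁺ : ∀ {e v i} → i ∈ E → i < e → e ≤ S i → S i ≡ v → v ∈ chain e
  ∈chain⁺ {e} {v} {i} i∈ i<e e≤ eq =
    subst (v ∈_) (sym (chain≡ e)) (∈-filterR⁺ {λ v → elemᵇ v (map S (filterᵇ (λ i → (i <ᵇ e) ∧ (e ≤ᵇ S i)) E))} rr
      (∈⇒elemᵇ (subst (_∈ _) eq (∈-map⁺ S (∈-filter⁺ (T? ∘ λ i → (i <ᵇ e) ∧ (e ≤ᵇ S i)) i∈ (∧-T (<⇒<ᵇ i<e) (≤⇒≤ᵇ e≤)))))))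
    where
    rr : InRange m v
    rr = subst (InRange m) eq (pinto i (proj₁ (∈E⁻ i∈)))

  Incchain : ∀ e → Increasing (chain e)
  Incchain e = subst Increasing (sym (chain≡ e)) (Increasing-filterR _ m)

  SlideCase : ℕ → ℕ → Set
  SlideCase c d = (d ≡ suc t × c ≡ 0) ⊎ (d ≤ t × c ≡ s + d)

  s≤m : s ≤ m
  s≤m = subst (s ≤_) st (m≤m+n s t)

  SlideCase⇒≤ : ∀ {c d} → SlideCase c d → c ≤ m
  SlideCase⇒≤ (inj₁ (_ , refl)) = z≤n
  SlideCase⇒≤ (inj₂ (d≤t , refl)) = subst (s + _ ≤_) st (+-monoʳ-≤ s d≤t)

  module SlideK (d : ℕ) (rd : InRange (suc t) d) = Slide K n d IncK (subst (1 ≤_) (sym lenK) (s≤s z≤n)) lastK' (rK rd)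

  Shat∘slide-into : ∀ d → InRange (suc t) d → MapsInto n (Shat ∘ slide K d n)
  Shat∘slide-into d rd = MapsInto-∘ n (slide K d n) Shat (SlideK.slide-into d rd K-InR) PS.pinto

  Shat∘slide-inj : ∀ d → InRange (suc t) d → InjectiveOn n (Shat ∘ slide K d n)
  Shat∘slide-inj d rd = InjectiveOn-∘ n (slide K d n) Shat (SlideK.slide-into d rd K-InR) (SlideK.slide-inj d rd) PS.pinj

  phiB-entry≡ : ∀ d → InRange (suc t) d → ∀ r → InRange n r → Shat (slide K d n r) ≡ phiB-entry n σ d r
  phiB-entry≡ d rd r rr = trans (if-float Shat (elemᵇ r K) {y = r}) (if-cong-T inK notK)
    where
    r≤m : r ≢ n → r ≤ m
    r≤m = InRange-suc⇒≤ rr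
    notK : ¬ T (elemᵇ r K) → Shat r ≡ S r
    notK h = Shat-lo r (r≤m (λ eq → h (∈⇒elemᵇ (subst (_∈ K) (sym eq) n∈K))))
    inK : T (elemᵇ r K) → _
    inK h = trans (if-float Shat (d <ᵇ indexOf r K)) (if-cong-T gt (λ ngt → trans (if-float Shat (indexOf r K ≡ᵇ d)) (if-cong-T (λ _ → Shat-n) (λ neq → Shat-lo r (r≤m (λ eq → ngt' ngt neq eq))))))
      where
      sp = idxK-spec (elemᵇ⇒∈ h)
      gt : T (d <ᵇ indexOf r K) → Shat (at K (indexOf r K ∸ 1)) ≡ S (at K (indexOf r K ∸ 1))
      gt lt = Shat-lo _ (proj₂ (proj₁ (∈NE⁻ (atK-NE _ ri'))))
        where
        ri' : InRange t (indexOf r K ∸ 1)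
        ri' = pred-range d (indexOf r K) t (proj₁ rd) (T-<ᵇ lt) (proj₂ (proj₁ sp))
      ngt' : ¬ T (d <ᵇ indexOf r K) → ¬ T (indexOf r K ≡ᵇ d) → ¬ r ≡ n
      ngt' a b refl rewrite idx-n with m≤n⇒m<n∨m≡n (proj₂ rd)
      ... | inj₁ lt = a (<⇒<ᵇ lt)
      ... | inj₂ eq = b (≡ᵇ-T (sym eq))

  phiDen≡slide : ∀ c d → InRange (suc t) d → SlideCase c d → phiDen n σ c ≡ map (Shat ∘ slide K d n) (range1 n)
  phiDen≡slide c d rd (inj₁ (refl , refl)) =
    at-ext (σ ++ [ n ]) n _ (trans (length-snoc σ n) (cong suc plen))
           (λ i _ → cong Shat (sym (SlideK.slide-last-id (suc t) rd lenK i)))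
  phiDen≡slide (suc c') d rd (inj₂ (d≤t , ceq)) =
    trans (phiDen-suc n σ c') (trans (if-¬T (¬≤ᵇ s<c)) (trans (cong (λ z → map (phiB-entry n σ z) (range1 n)) dd) (sym (map-cong-range1 n _ _ (phiB-entry≡ d rd)))))
    where
    s<c : s < suc c'
    s<c = subst (s <_) (sym ceq) (subst (_≤ s + d) (+-comm s 1) (+-monoʳ-≤ s (proj₁ rd)))
    dd : suc c' ∸ s ≡ d
    dd = trans (cong (_∸ s) ceq) (m+n∸m≡n s d)
  phiDen≡slide zero (suc d') rd (inj₂ (d≤t , ceq)) = ⊥-elim (0≢1+n (trans ceq (+-suc s d')))

  c-cases : ∀ c → c ≤ m → (∃[ c' ] (c ≡ suc c' × suc c' ≤ s)) ⊎ (∃[ d ] (InRange (suc t) d × SlideCase c d))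
  c-cases zero _ = inj₂ (suc t , (s≤s z≤n , ≤-refl) , inj₁ (refl , refl))
  c-cases (suc c') c≤m with suc c' ≤? s
  ... | yes le = inj₁ (c' , refl , le)
  ... | no nle = inj₂ (suc c' ∸ s , (lo , ≤-trans hi (n≤1+n t)) , inj₂ (hi , sym (m+[n∸m]≡n (<⇒≤ (≰⇒> nle)))))
    where
    lo : 1 ≤ suc c' ∸ s
    lo = subst (1 ≤_) (sym (+-∸-assoc 1 (≤-pred (≰⇒> nle)))) (s≤s z≤n)
    hi : suc c' ∸ s ≤ t
    hi = subst (suc c' ∸ s ≤_) (m+n∸m≡n s t) (subst (λ z → suc c' ∸ s ≤ z ∸ s) (sym st) (∸-monoˡ-≤ s c≤m))


nextIn-if : ∀ n ch v → nextIn n ch v ≡ (if elemᵇ v ch then nextIn n ch v else v)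
nextIn-if n ch v with elemᵇ v ch in eq
... | true = refl
... | false = nextIn-∉ n ch v (λ h → subst T eq (∈⇒elemᵇ h))

module CycleCase (m : ℕ) (σ : List ℕ) (pσ : IsPerm m σ) (c' : ℕ) (c≤s : suc c' ≤ Excedances.s m σ pσ) where
  open Excedances m σ pσ
  c : ℕ
  c = suc c'
  dA : ℕ
  dA = suc s ∸ c

  rdA : InRange (length EL) dA
  rdA = subst (λ L → InRange L dA) (sym lenEL) (lo , hi)
    where
    lo : 1 ≤ suc s ∸ suc c'
    lo = subst (1 ≤_) (sym (+-∸-assoc 1 c≤s)) (s≤s z≤n)
    hi : suc s ∸ suc c' ≤ s
    hi = m∸n≤m s c'

  e : ℕ
  e = at EL dA

  e∈EL : e ∈ EL
  e∈EL = at-∈ EL dA rdA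

  eR : InRange m e
  eR = proj₁ (∈EL⁻ e∈EL)

  iₑ : ℕ
  iₑ = proj₁ (proj₂ (∈EL⁻ e∈EL))
  iₑ∈E : iₑ ∈ E
  iₑ∈E = proj₁ (proj₂ (proj₂ (∈EL⁻ e∈EL)))
  Siₑ : S iₑ ≡ e
  Siₑ = proj₂ (proj₂ (proj₂ (∈EL⁻ e∈EL)))

  iₑ<e : iₑ < e
  iₑ<e = subst (iₑ <_) Siₑ (proj₂ (∈E⁻ iₑ∈E))

  e∈ch : e ∈ chain e
  e∈ch = ∈chain⁺ iₑ∈E iₑ<e (≤-reflexive (sym Siₑ)) Siₑ

  ch-min : ∀ v → v ∈ chain e → e ≤ v
  ch-min v h with ∈chain⁻ {e} h
  ... | _ , i , _ , _ , le , eq = subst (e ≤_) eq le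

  rest : List ℕ
  rest = drop 1 (chain e)

  ch≡ : chain e ≡ e ∷ rest
  ch≡ = Increasing-head (Incchain e) e∈ch ch-min

  I : Increasing (e ∷ rest ++ [ n ])
  I = subst (λ L → Increasing (L ++ [ n ])) ch≡ (Increasing-∷ʳ n (Incchain e) (λ v h → s≤s (proj₂ (proj₁ (∈chain⁻ {e} h)))))

  open ChainCycle n e rest I public

  y : ℕ
  y = firstGeq e K

  y-spec : InRange (length K) y × at K (y ∸ 1) < e × e ≤ at K y
  y-spec = firstGeq-spec IncK e n (proj₁ eR) n∈K (≤-trans (proj₂ eR) (n≤1+n m))

  yR : InRange (suc t) y
  yR = Kr (proj₁ y-spec)

  y-lt : at K (y ∸ 1) < e
  y-lt = proj₁ (proj₂ y-spec)

  y-ge : e ≤ at K y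
  y-ge = proj₂ (proj₂ y-spec)

  A : ℕ → ℕ
  A = cycle n e (chain e)

  A≡ : ∀ v → A v ≡ cycle n e C v
  A≡ v = cong (λ L → cycle n e L v) ch≡

  S≢n : ∀ k → k ≤ m → ¬ T (S k ≡ᵇ n)
  S≢n k le t' with k ≟ 0
  ... | yes refl = ⊥-elim (0≢1+n (trans (sym (at-0 σ)) (T-≡ᵇ t')))
  ... | no k≢0 = <-irrefl (T-≡ᵇ t') (s≤s (proj₂ (pinto k (n≢0⇒n>0 k≢0 , le))))

  A-fixNE : ∀ k → k ∈ NE → A (S k) ≡ S k
  A-fixNE k k∈ = trans (if-¬T (S≢n k (proj₂ (proj₁ (∈NE⁻ k∈))))) (nextIn-∉ n (chain e) (S k) nin)
    where
    nin : S k ∉ chain e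
    nin h with ∈chain⁻ {e} h
    ... | _ , i , i∈ , _ , _ , eq = S-NE≢S-E k∈ i∈ (sym eq)

  An : A n ≡ e
  An = if-T (≡ᵇ-T {n} refl)

  phiA-entry≡ : ∀ r → InRange n r → A (Shat (slide K y n r)) ≡ phiA-entry n σ c r
  phiA-entry≡ r rr = trans (if-float (λ x → A (Shat x)) (elemᵇ r K) {y = r}) (if-cong-T inK notK)
    where
    r≤m : r ≢ n → r ≤ m
    r≤m = InRange-suc⇒≤ rr
    notK : ¬ T (elemᵇ r K) → A (Shat r) ≡ (if elemᵇ (S r) (chain e) then nextIn n (chain e) (S r) else S r)
    notK h = trans (cong A (Shat-lo r rm)) (trans (if-¬T (S≢n r rm)) (nextIn-if n (chain e) (S r)))
      where
      rm = r≤m (λ eq → h (∈⇒elemᵇ (subst (_∈ K) (sym eq) n∈K)))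
    inK : T (elemᵇ r K) → _
    inK h = trans (if-float (λ x → A (Shat x)) (y <ᵇ indexOf r K))
              (if-cong-T gt (λ ngt → trans (if-float (λ x → A (Shat x)) (indexOf r K ≡ᵇ y))
                 (if-cong-T (λ _ → trans (cong A Shat-n) An) (λ neq → lo ngt neq))))
      where
      sp = idxK-spec (elemᵇ⇒∈ h)
      gt : T (y <ᵇ indexOf r K) → A (Shat (at K (indexOf r K ∸ 1))) ≡ S (at K (indexOf r K ∸ 1))
      gt lt = trans (cong A (Shat-lo _ (proj₂ (proj₁ (∈NE⁻ k∈))))) (A-fixNE _ k∈)
        where
        k∈ = atK-NE _ (pred-range y (indexOf r K) t (proj₁ yR) (T-<ᵇ lt) (proj₂ (proj₁ sp)))
      ngt' : ¬ T (y <ᵇ indexOf r K) → ¬ T (indexOf r K ≡ᵇ y) → ¬ r ≡ n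
      ngt' a b refl rewrite idx-n with m≤n⇒m<n∨m≡n (proj₂ yR)
      ... | inj₁ lt = a (<⇒<ᵇ lt)
      ... | inj₂ eq = b (≡ᵇ-T (sym eq))
      lo : ¬ T (y <ᵇ indexOf r K) → ¬ T (indexOf r K ≡ᵇ y) → A (Shat r) ≡ S r
      lo a b with ∈K⁻ (elemᵇ⇒∈ h)
      ... | inj₂ eq = ⊥-elim (ngt' a b eq)
      ... | inj₁ r∈ = trans (cong A (Shat-lo r (proj₂ (proj₁ (∈NE⁻ r∈))))) (A-fixNE r r∈)

  phiDen≡cycle∘slide : phiDen n σ c ≡ map (A ∘ Shat ∘ slide K y n) (range1 n)
  phiDen≡cycle∘slide = trans (phiDen-suc n σ c') (trans (if-T (≤⇒≤ᵇ c≤s)) (sym (map-cong-range1 n _ _ phiA-entry≡)))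

  A-into : MapsInto n A
  A-into v r = subst (InRange n) (sym (A≡ v)) (cycle-into v r (proj₁ eR))

  A-inj : InjectiveOn n A
  A-inj = leftInverse⇒injectiveOn n A (cycle⁻¹ n e D) (λ v _ → trans (cong (cycle⁻¹ n e D) (A≡ v)) (cycle⁻¹∘cycle v))

  A∘Shat∘slide-into : MapsInto n (A ∘ Shat ∘ slide K y n)
  A∘Shat∘slide-into = MapsInto-∘ n _ A (Shat∘slide-into y yR) A-into

  A∘Shat∘slide-inj : InjectiveOn n (A ∘ Shat ∘ slide K y n)
  A∘Shat∘slide-inj = InjectiveOn-∘ n _ A (Shat∘slide-into y yR) (Shat∘slide-inj y yR) A-inj

phiDen-isPerm : ∀ m σ c → IsPerm m σ → c ≤ m → IsPerm (suc m) (phiDen (suc m) σ c)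
phiDen-isPerm m σ c pσ c≤m with Excedances.c-cases m σ pσ c c≤m
... | inj₁ (c' , refl , c≤s) =
  subst (IsPerm (suc m)) (sym (CycleCase.phiDen≡cycle∘slide m σ pσ c' c≤s))
        (map-range1-isPerm (suc m) _ (CycleCase.A∘Shat∘slide-into m σ pσ c' c≤s) (CycleCase.A∘Shat∘slide-inj m σ pσ c' c≤s))
... | inj₂ (d , rd , sc) =
  subst (IsPerm (suc m)) (sym (Excedances.phiDen≡slide m σ pσ c d rd sc))
        (map-range1-isPerm (suc m) _ (Excedances.Shat∘slide-into m σ pσ d rd) (Excedances.Shat∘slide-inj m σ pσ d rd))

-- The inverse ψ

-- If p < Kw[Jw] and p < e, w comes from the case 1 ≤ c ≤ s:
-- then Kw = K, Jw = y, e = e_d, and the chain with e removed and n added is chainW, the letters v ≥ e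
-- whose position is below e. Otherwise n was put at p = k_d, and the nonexcedances of σ together
-- with n form Kp = Kw ∪ {p}, in which p has index dB = d.
module Psi (n : ℕ) (w : List ℕ) where
  W : ℕ → ℕ
  W = at w
  Kw : List ℕ
  Kw = nonExcPos w
  rise : ℕ → Bool
  rise j = at Kw (j ∸ 1) <ᵇ W (at Kw j)
  Jw : ℕ
  Jw = lastTrue rise (length Kw)
  kJ : ℕ
  kJ = at Kw Jw
  e : ℕ
  e = W kJ
  p : ℕ
  p = indexOf n w
  isCycle : Bool
  isCycle = (p <ᵇ kJ) ∧ (p <ᵇ e)
  chainW : List ℕ
  chainW = filterᵇ (λ v → (e ≤ᵇ v) ∧ (indexOf v w <ᵇ e)) (range1 n)
  Kp : List ℕ
  Kp = filterᵇ (λ q → (q ≡ᵇ p) ∨ not (q <ᵇ W q)) (range1 n)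
  dB : ℕ
  dB = indexOf p Kp
  psiσ-entry : ℕ → ℕ
  psiσ-entry r = if isCycle then cycle⁻¹ n e chainW (W (slide⁻¹ Kw Jw r)) else W (slide⁻¹ Kp dB r)
  psiσ : List ℕ
  psiσ = map psiσ-entry (range1 (n ∸ 1))
  psiC : ℕ
  psiC = if isCycle then suc (exc psiσ) ∸ indexOf e (excLetters psiσ) else (if p ≡ᵇ n then 0 else exc psiσ + dB)

module PsiFacts (m : ℕ) (w : List ℕ) (pw : IsPerm (suc m) w) where
  open Psi (suc m) w public
  open PermFacts pw public
  n : ℕ
  n = suc m

  n∈Kw : n ∈ Kw
  n∈Kw = ∈NE⁺ (s≤s z≤n , ≤-refl) (proj₂ (pinto n (s≤s z≤n , ≤-refl)))

  Kw-InR : ∀ x → x ∈ Kw → InRange n x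
  Kw-InR x h = proj₁ (∈NE⁻ h)

  L : ℕ
  L = length Kw

  L≥1 : 1 ≤ L
  L≥1 with ∈⇒at n∈Kw
  ... | i , ri , _ = ≤-trans (proj₁ ri) (proj₂ ri)

  lastKw : at Kw L ≡ n
  lastKw = Increasing-last IncNE n∈Kw (λ x h → proj₂ (Kw-InR x h))

  W≥1 : ∀ q → InRange n q → 1 ≤ W q
  W≥1 q r = proj₁ (pinto q r)

  rise-1 : T (rise 1)
  rise-1 = <⇒<ᵇ (subst (_< W (at Kw 1)) (sym (at-0 Kw)) (W≥1 _ (Kw-InR _ (at-∈ Kw 1 (s≤s z≤n , L≥1)))))

  Jw-spec : 1 ≤ Jw × T (rise Jw) × (∀ j → Jw < j → j ≤ L → ¬ T (rise j))
  Jw-spec = lastTrue-spec rise L L≥1 rise-1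

  Jw≥1 : 1 ≤ Jw
  Jw≥1 = proj₁ Jw-spec

  rise-Jw : T (rise Jw)
  rise-Jw = proj₁ (proj₂ Jw-spec)

  ¬rise->Jw : ∀ j → Jw < j → j ≤ L → ¬ T (rise j)
  ¬rise->Jw = proj₂ (proj₂ Jw-spec)

  JwR : InRange L Jw
  JwR = Jw≥1 , lastTrue-≤ rise L

  kJ∈Kw : kJ ∈ Kw
  kJ∈Kw = at-∈ Kw Jw JwR

  e≤kJ : e ≤ kJ
  e≤kJ = proj₂ (∈NE⁻ kJ∈Kw)

  kJR : InRange n kJ
  kJR = Kw-InR kJ kJ∈Kw

  eR : InRange n e
  eR = pinto kJ kJR

  <kJ⇒<e : ∀ x → x ∈ Kw → x < kJ → x < e
  <kJ⇒<e x x∈ lt = <at⇒< IncNE Jw e JwR (T-<ᵇ rise-Jw) x x∈ lt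

  fall->Jw : ∀ j → Jw < j → j ≤ L → W (at Kw j) ≤ at Kw (j ∸ 1)
  fall->Jw j lt hi = ≮⇒≥ (λ l → ¬rise->Jw j lt hi (<⇒<ᵇ l))

  fall-after-kJ : ∀ q → q ∈ Kw → kJ < q → ∃[ q' ] (q' ∈ Kw × q' < q × W q ≤ q')
  fall-after-kJ q q∈ lt with ∈⇒at q∈
  ... | suc zero , rq , refl = ⊥-elim (<⇒≱ (at-reflects-< IncNE Jw 1 JwR rq lt) Jw≥1)
  ... | suc (suc j) , rq , refl =
    at Kw (suc j) , at-∈ Kw (suc j) (s≤s z≤n , ≤-trans (n≤1+n _) (proj₂ rq)) ,
    at-strictMono IncNE (suc j) (suc (suc j)) (s≤s z≤n) ≤-refl (proj₂ rq) ,
    fall->Jw (suc (suc j)) (at-reflects-< IncNE Jw (suc (suc j)) JwR rq lt) (proj₂ rq)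

  pspec : InRange n p × W p ≡ n
  pspec = pidx {n} (s≤s z≤n , ≤-refl)

  pR : InRange n p
  pR = proj₁ pspec

  Wp : W p ≡ n
  Wp = proj₂ pspec

  ∈Kp⁻ : ∀ {q} → q ∈ Kp → InRange n q × (q ≡ p ⊎ W q ≤ q)
  ∈Kp⁻ {q} h with ∈-filterR⁻ {λ q → (q ≡ᵇ p) ∨ not (q <ᵇ W q)} {n} h
  ... | rr , tt' with T-∨ {q ≡ᵇ p} tt'
  ...   | inj₁ a = rr , inj₁ (T-≡ᵇ a)
  ...   | inj₂ b = rr , inj₂ (≮⇒≥ (λ lt → T-not b (<⇒<ᵇ lt)))

  ∈Kp⁺ : ∀ {q} → InRange n q → (q ≡ p ⊎ W q ≤ q) → q ∈ Kp
  ∈Kp⁺ {q} rr (inj₁ eq) = ∈-filterR⁺ {λ q → (q ≡ᵇ p) ∨ not (q <ᵇ W q)} rr (∨-Tˡ (≡ᵇ-T eq))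
  ∈Kp⁺ {q} rr (inj₂ le) = ∈-filterR⁺ {λ q → (q ≡ᵇ p) ∨ not (q <ᵇ W q)} rr (∨-Tʳ {q ≡ᵇ p} (not-T (¬<ᵇ le)))

  IncKp : Increasing Kp
  IncKp = Increasing-filterR (λ q → (q ≡ᵇ p) ∨ not (q <ᵇ W q)) n

  Kp-InR : ∀ x → x ∈ Kp → InRange n x
  Kp-InR x h = proj₁ (∈Kp⁻ h)

  p∈Kp : p ∈ Kp
  p∈Kp = ∈Kp⁺ pR (inj₁ refl)

  Kw⊆Kp : ∀ {q} → q ∈ Kw → q ∈ Kp
  Kw⊆Kp h = ∈Kp⁺ (proj₁ (∈NE⁻ h)) (inj₂ (proj₂ (∈NE⁻ h)))

  n∈Kp : n ∈ Kp
  n∈Kp = Kw⊆Kp n∈Kw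

  Lp : ℕ
  Lp = length Kp

  Lp≥1 : 1 ≤ Lp
  Lp≥1 with ∈⇒at n∈Kp
  ... | i , ri , _ = ≤-trans (proj₁ ri) (proj₂ ri)

  lastKp : at Kp Lp ≡ n
  lastKp = Increasing-last IncKp n∈Kp (λ x h → proj₂ (Kp-InR x h))

  dBspec : InRange Lp dB × at Kp dB ≡ p
  dBspec = indexOf-∈ p∈Kp

  dBR : InRange Lp dB
  dBR = proj₁ dBspec

  atdB : at Kp dB ≡ p
  atdB = proj₂ dBspec

  ∈chW⁻ : ∀ {v} → v ∈ chainW → InRange n v × e ≤ v × indexOf v w < e
  ∈chW⁻ {v} h with ∈-filterR⁻ {λ v → (e ≤ᵇ v) ∧ (indexOf v w <ᵇ e)} {n} h
  ... | rr , tt' = rr , T-≤ᵇ (proj₁ (T-∧ tt')) , T-<ᵇ (proj₂ (T-∧ {e ≤ᵇ v} tt'))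

  ∈chW⁺ : ∀ {v} → InRange n v → e ≤ v → indexOf v w < e → v ∈ chainW
  ∈chW⁺ rr a b = ∈-filterR⁺ {λ v → (e ≤ᵇ v) ∧ (indexOf v w <ᵇ e)} rr (∧-T (≤⇒≤ᵇ a) (<⇒<ᵇ b))

  IncchW : Increasing chainW
  IncchW = Increasing-filterR (λ v → (e ≤ᵇ v) ∧ (indexOf v w <ᵇ e)) n



-- ψ ∘ φ = id

module PsiPhiSlide (m : ℕ) (σ : List ℕ) (pσ : IsPerm m σ) (c d : ℕ) (rd : InRange (suc (Excedances.t m σ pσ)) d)
           (hc : Excedances.SlideCase m σ pσ c d)
           (w : List ℕ) (pw : IsPerm (suc m) w)
           (wF : ∀ r → InRange (suc m) r → at w r ≡ Excedances.Shat m σ pσ (slide (Excedances.K m σ pσ) d (suc m) r)) where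
  open Excedances m σ pσ
  module Ψ = PsiFacts m w pw
  open SlideK d rd

  rKd : InRange n (at K d)
  rKd = K-InR _ (at-∈ K d (rK rd))

  WKd : Ψ.W (at K d) ≡ n
  WKd = trans (wF _ rKd) (trans (cong Shat slide-≡) Shat-n)

  pEq : Ψ.p ≡ at K d
  pEq = trans (cong (λ v → indexOf v w) (sym WKd)) (Ψ.pindexOf (at K d) rKd)

  W-gt : ∀ i → InRange (suc t) i → d < i → Ψ.W (at K i) ≡ S (at K (i ∸ 1)) × at K (i ∸ 1) ∈ NE
  W-gt i ri d<i = trans (wF _ (K-InR _ (at-∈ K i (rK ri)))) (trans (cong Shat (slide-> i (rK ri) d<i)) (Shat-lo _ (proj₂ (proj₁ (∈NE⁻ k∈))))) , k∈
    where
    k∈ = atK-NE (i ∸ 1) (pred-range d i t (proj₁ rd) d<i (proj₂ ri))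

  W-lt : ∀ i → InRange (suc t) i → i < d → Ψ.W (at K i) ≡ S (at K i) × at K i ∈ NE
  W-lt i ri i<d = trans (wF _ (K-InR _ (at-∈ K i (rK ri)))) (trans (cong Shat (slide-< i (rK ri) i<d)) (Shat-lo _ (proj₂ (proj₁ (∈NE⁻ k∈))))) , k∈
    where
    k∈ = atK-NE i (proj₁ ri , ≤-pred (<-≤-trans i<d (proj₂ rd)))

  W-out : ∀ r → InRange n r → r ∉ K → Ψ.W r ≡ S r × r ≤ m
  W-out r rr r∉ = trans (wF r rr) (trans (cong Shat (slide-∉ r r∉)) (Shat-lo r rm)) , rm
    where
    rm = InRange-suc⇒≤ rr (λ eq → r∉ (subst (_∈ K) (sym eq) n∈K))

  KpEq : Ψ.Kp ≡ K
  KpEq = Increasing-ext Ψ.IncKp IncK to from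
    where
    to : ∀ q → q ∈ Ψ.Kp → q ∈ K
    to q h with Ψ.∈Kp⁻ h
    ... | rr , inj₁ eq = subst (_∈ K) (sym (trans eq pEq)) (at-∈ K d (rK rd))
    ... | rr , inj₂ le with q ∈? K
    ...   | yes q∈ = q∈
    ...   | no q∉ = ⊥-elim (q∉ (NE⊆K (∈NE⁺ (proj₁ rr , proj₂ (W-out q rr q∉)) (subst (_≤ q) (proj₁ (W-out q rr q∉)) le))))
    from : ∀ q → q ∈ K → q ∈ Ψ.Kp
    from q h with idxK-spec h
    ... | ri , eq = subst (_∈ Ψ.Kp) eq (fromAt (indexOf q K) ri)
      where
      fromAt : ∀ i → InRange (suc t) i → at K i ∈ Ψ.Kp
      fromAt i ri with <-cmp i d
      ... | tri≈ _ eq' _ = Ψ.∈Kp⁺ (K-InR _ (at-∈ K i (rK ri))) (inj₁ (trans (cong (at K) eq') (sym pEq)))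
      ... | tri< lt _ _ = Ψ.∈Kp⁺ (K-InR _ (at-∈ K i (rK ri))) (inj₂ (subst (_≤ _) (sym (proj₁ (W-lt _ ri lt))) (proj₂ (∈NE⁻ (proj₂ (W-lt _ ri lt))))))
      ... | tri> _ _ gt = Ψ.∈Kp⁺ (K-InR _ (at-∈ K i (rK ri))) (inj₂ (subst (_≤ _) (sym (proj₁ (W-gt _ ri gt)))
                 (≤-trans (proj₂ (∈NE⁻ (proj₂ (W-gt _ ri gt)))) (<⇒≤ (at-strictMono IncK _ _ (proj₁ (pred-range d _ t (proj₁ rd) gt (proj₂ ri))) (i∸1<i _ (≤-trans (proj₁ rd) (<⇒≤ gt))) (proj₂ (rK ri)))))))

  -- kJ = k_i comes after p = k_d, so e = w(k_i) = σ(k_{i-1}) ≤ k_{i-1}; yet k_{i-1} is either p or a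
  -- nonexcedance of w before kJ, and both lie below e.
  ¬isCycle : ¬ T Ψ.isCycle
  ¬isCycle cyc with T-∧ cyc
  ... | p<kJ' , p<e' = contra
    where
    p<kJ = T-<ᵇ p<kJ'
    p<e = T-<ᵇ {Ψ.p} p<e'
    qJ∈K : Ψ.kJ ∈ K
    qJ∈K = subst (Ψ.kJ ∈_) KpEq (Ψ.Kw⊆Kp Ψ.kJ∈Kw)
    contra : ⊥
    contra with idxK-spec qJ∈K
    ... | ri , eqq = body
      where
      i = indexOf Ψ.kJ K
      d<i : d < i
      d<i = at-reflects-< IncK d i (rK rd) (rK ri) (subst₂ _<_ pEq (sym eqq) p<kJ)
      k' = at K (i ∸ 1)
      ri' = pred-range d i t (proj₁ rd) d<i (proj₂ ri)
      e≤k' : Ψ.e ≤ k'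
      e≤k' = subst (_≤ k') (sym (trans (cong Ψ.W (sym eqq)) (proj₁ (W-gt i ri d<i)))) (proj₂ (∈NE⁻ (proj₂ (W-gt i ri d<i))))
      k'<qJ : k' < Ψ.kJ
      k'<qJ = subst (k' <_) eqq (at-strictMono IncK (i ∸ 1) i (proj₁ ri') (i∸1<i i (≤-trans (proj₁ rd) (<⇒≤ d<i))) (proj₂ (rK ri)))
      k'∈Kp : k' ∈ Ψ.Kp
      k'∈Kp = subst (k' ∈_) (sym KpEq) (at-∈ K (i ∸ 1) (rK (proj₁ ri' , ≤-trans (proj₂ ri') (n≤1+n t))))
      body : ⊥
      body with Ψ.∈Kp⁻ k'∈Kp
      ... | _ , inj₁ eq = <⇒≱ p<e (subst (Ψ.e ≤_) eq e≤k')
      ... | rr , inj₂ le = <⇒≱ (Ψ.<kJ⇒<e k' (Ψ.∈NE⁺ rr le) k'<qJ) e≤k'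

  dBEq : Ψ.dB ≡ d
  dBEq = trans (cong₂ indexOf pEq KpEq) (idxK d rd)

  sigF≡ : ∀ r → Ψ.psiσ-entry r ≡ Ψ.W (slide⁻¹ K d r)
  sigF≡ r = trans (if-¬T ¬isCycle) (cong₂ (λ L j → Ψ.W (slide⁻¹ L j r)) KpEq dBEq)

  sigEq : Ψ.psiσ ≡ σ
  sigEq = sym (at-ext σ m Ψ.psiσ-entry plen pt)
    where
    pt : ∀ i → InRange m i → at σ i ≡ Ψ.psiσ-entry i
    pt i ri = sym (trans (sigF≡ i) (trans (wF _ (slide⁻¹-into K-InR i (InRange-suc ri)))
               (trans (cong Shat (slide∘slide⁻¹ i)) (Shat-lo i (proj₂ ri)))))

  ccEq : Ψ.psiC ≡ c
  ccEq = trans (if-¬T ¬isCycle) (body hc)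
    where
    body : SlideCase c d → (if Ψ.p ≡ᵇ n then 0 else exc Ψ.psiσ + Ψ.dB) ≡ c
    body (inj₁ (deq , ceq)) = trans (if-T (≡ᵇ-T (trans pEq (trans (cong (at K) deq) lastK)))) (sym ceq)
    body (inj₂ (d≤t , ceq)) = trans (if-¬T (¬≡ᵇ pn)) (trans (cong₂ _+_ (cong exc sigEq) dBEq) (sym ceq))
      where
      pn : Ψ.p ≢ n
      pn eq = <-irrefl (trans (sym pEq) (trans eq (sym lastK)))
                (at-strictMono IncK d (suc t) (proj₁ rd) (s≤s d≤t) (proj₂ (rK (s≤s z≤n , ≤-refl))))




module PsiPhiCycle (m : ℕ) (σ : List ℕ) (pσ : IsPerm m σ) (c' : ℕ) (c≤s : suc c' ≤ Excedances.s m σ pσ)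
           (w : List ℕ) (pw : IsPerm (suc m) w)
           (wF : ∀ r → InRange (suc m) r → at w r ≡ CycleCase.A m σ pσ c' c≤s (Excedances.Shat m σ pσ (slide (Excedances.K m σ pσ) (CycleCase.y m σ pσ c' c≤s) (suc m) r))) where
  open Excedances m σ pσ
  open CycleCase m σ pσ c' c≤s
  module Ψ = PsiFacts m w pw
  open SlideK y yR

  W-gt : ∀ i → InRange (suc t) i → y < i → Ψ.W (at K i) ≡ S (at K (i ∸ 1)) × at K (i ∸ 1) ∈ NE
  W-gt i ri y<i = trans (wF _ (K-InR _ (at-∈ K i (rK ri)))) (trans (cong (λ x → A (Shat x)) (slide-> i (rK ri) y<i))
                    (trans (cong A (Shat-lo _ (proj₂ (proj₁ (∈NE⁻ k∈))))) (A-fixNE _ k∈))) , k∈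
    where
    k∈ = atK-NE (i ∸ 1) (pred-range y i t (proj₁ yR) y<i (proj₂ ri))

  W-eq : Ψ.W (at K y) ≡ e
  W-eq = trans (wF _ (K-InR _ (at-∈ K y (rK yR)))) (trans (cong (λ x → A (Shat x)) slide-≡) (trans (cong A Shat-n) An))

  W-lt : ∀ i → InRange (suc t) i → i < y → Ψ.W (at K i) ≡ S (at K i) × at K i ∈ NE
  W-lt i ri i<y = trans (wF _ (K-InR _ (at-∈ K i (rK ri)))) (trans (cong (λ x → A (Shat x)) (slide-< i (rK ri) i<y))
                    (trans (cong A (Shat-lo _ (proj₂ (proj₁ (∈NE⁻ k∈))))) (A-fixNE _ k∈))) , k∈
    where
    k∈ = atK-NE i (proj₁ ri , ≤-pred (<-≤-trans i<y (proj₂ yR)))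

  W-out : ∀ r → InRange n r → r ∉ K → Ψ.W r ≡ A (S r) × r ≤ m
  W-out r rr r∉ = trans (wF r rr) (trans (cong (λ x → A (Shat x)) (slide-∉ r r∉)) (cong A (Shat-lo r rm))) , rm
    where
    rm = InRange-suc⇒≤ rr (λ eq → r∉ (subst (_∈ K) (sym eq) n∈K))

  E∉K : ∀ {r} → r ∈ E → r ∉ K
  E∉K {r} r∈ h with ∈K⁻ h
  ... | inj₁ q = <⇒≱ (proj₂ (∈E⁻ r∈)) (proj₂ (∈NE⁻ q))
  ... | inj₂ refl = <-irrefl refl (s≤s (proj₂ (proj₁ (∈E⁻ r∈))))

  ∉K-E : ∀ {r} → InRange n r → r ∉ K → r ∈ E × r ≤ m
  ∉K-E {r} rr r∉ = ∈E⁺ (proj₁ rr , rm) (≰⇒> (λ le → r∉ (NE⊆K (∈NE⁺ (proj₁ rr , rm) le)))) , rm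
    where
    rm = proj₂ (W-out r rr r∉)

  E-R : ∀ {r} → r ∈ E → InRange n r
  E-R r∈ = InRange-suc (proj₁ (∈E⁻ r∈))

  chC : ∀ {v} → v ∈ chain e → v ∈ C
  chC h = subst (_ ∈_) ch≡ h

  Cch : ∀ {v} → v ∈ C → v ∈ chain e
  Cch h = subst (_ ∈_) (sym ch≡) h

  D≤n : ∀ {v} → v ∈ D → v ≤ n
  D≤n h with ∈-snoc⁻ {rest} h
  ... | inj₁ q = <⇒≤ (rest<n q)
  ... | inj₂ refl = ≤-refl

  -- n = A u for the last chain letter u, whose position r0 is an excedance of σ; this is where w puts n.
  u : ℕ
  u = cycle⁻¹ n e D n
  n≢e : ¬ T (n ≡ᵇ e)
  n≢e t' = <-irrefl (sym (T-≡ᵇ t')) (e<D (∈-snoc-last rest n))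
  u∈C : u ∈ C
  u∈C = subst (_∈ C) (sym (if-¬T n≢e)) (prevIn-∈ n e rest n (∈-snoc-last rest n))
  Au : A u ≡ n
  Au = trans (A≡ u) (cycle∘cycle⁻¹ n)

  r0data : InRange m u × ∃[ i ] (i ∈ E × i < e × e ≤ S i × S i ≡ u)
  r0data = ∈chain⁻ {e} (Cch u∈C)
  r0 : ℕ
  r0 = proj₁ (proj₂ r0data)
  r0∈E : r0 ∈ E
  r0∈E = proj₁ (proj₂ (proj₂ r0data))
  r0<e : r0 < e
  r0<e = proj₁ (proj₂ (proj₂ (proj₂ r0data)))
  Sr0 : S r0 ≡ u
  Sr0 = proj₂ (proj₂ (proj₂ (proj₂ (proj₂ r0data))))

  Wr0 : Ψ.W r0 ≡ n
  Wr0 = trans (proj₁ (W-out r0 (E-R r0∈E) (E∉K r0∈E))) (trans (cong A Sr0) Au)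

  pEq : Ψ.p ≡ r0
  pEq = trans (cong (λ v → indexOf v w) (sym Wr0)) (Ψ.pindexOf r0 (E-R r0∈E))

  KwEq : Ψ.Kw ≡ K
  KwEq = Increasing-ext Ψ.IncNE IncK to from
    where
    to : ∀ q → q ∈ Ψ.Kw → q ∈ K
    to q h with q ∈? K
    ... | yes q∈ = q∈
    ... | no q∉ = ⊥-elim (<⇒≱ (<-≤-trans (proj₂ (∈E⁻ qE)) (A-≥' (S q) Sq<n)) (subst (_≤ q) (proj₁ (W-out q rr q∉)) (proj₂ (Ψ.∈NE⁻ h))))
      where
      rr = proj₁ (Ψ.∈NE⁻ h)
      qE = proj₁ (∉K-E rr q∉)
      Sq<n : S q < n
      Sq<n = s≤s (proj₂ (pinto q (proj₁ (∈E⁻ qE))))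
      A-≥' : ∀ v → v < n → v ≤ A v
      A-≥' v lt = subst (v ≤_) (sym (A≡ v)) (≤-cycle v lt)
    from : ∀ q → q ∈ K → q ∈ Ψ.Kw
    from q h with idxK-spec h
    ... | ri , eq = subst (_∈ Ψ.Kw) eq (fromAt (indexOf q K) ri)
      where
      fromAt : ∀ i → InRange (suc t) i → at K i ∈ Ψ.Kw
      fromAt i ri with <-cmp i y
      ... | tri≈ _ refl _ = Ψ.∈NE⁺ (K-InR _ (at-∈ K i (rK ri))) (subst (_≤ at K i) (sym W-eq) y-ge)
      ... | tri< lt _ _ = Ψ.∈NE⁺ (K-InR _ (at-∈ K i (rK ri))) (subst (_≤ _) (sym (proj₁ (W-lt _ ri lt))) (proj₂ (∈NE⁻ (proj₂ (W-lt _ ri lt)))))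
      ... | tri> _ _ gt = Ψ.∈NE⁺ (K-InR _ (at-∈ K i (rK ri))) (subst (_≤ _) (sym (proj₁ (W-gt _ ri gt)))
                 (≤-trans (proj₂ (∈NE⁻ (proj₂ (W-gt _ ri gt)))) (<⇒≤ (at-strictMono IncK _ _ (proj₁ (pred-range y _ t (proj₁ yR) gt (proj₂ ri))) (i∸1<i _ (≤-trans (proj₁ yR) (<⇒≤ gt))) (proj₂ (rK ri))))))

  JEq : Ψ.Jw ≡ y
  JEq = trans (cong (λ L → lastTrue (λ j → at L (j ∸ 1) <ᵇ Ψ.W (at L j)) (length L)) KwEq)
          (lastTrue-unique _ (length K) y (proj₁ yR) (proj₂ (rK yR)) (<⇒<ᵇ (subst (at K (y ∸ 1) <_) (sym W-eq) y-lt)) nb)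
    where
    nb : ∀ j → y < j → j ≤ length K → ¬ T (at K (j ∸ 1) <ᵇ Ψ.W (at K j))
    nb j lt hi = ¬<ᵇ (subst (_≤ _) (sym (proj₁ (W-gt j rj lt))) (proj₂ (∈NE⁻ (proj₂ (W-gt j rj lt)))))
      where
      rj = Kr (≤-trans (proj₁ yR) (<⇒≤ lt) , hi)

  qJEq : Ψ.kJ ≡ at K y
  qJEq = cong₂ at KwEq JEq

  eEq : Ψ.e ≡ e
  eEq = trans (cong Ψ.W qJEq) W-eq

  isCycle-true : T Ψ.isCycle
  isCycle-true = ∧-T (<⇒<ᵇ (subst₂ _<_ (sym pEq) (sym qJEq) (<-≤-trans r0<e y-ge))) (<⇒<ᵇ (subst₂ _<_ (sym pEq) (sym eEq) r0<e))

  ∈chainW⁻ : ∀ {v} → v ∈ Ψ.chainW → InRange n v × e ≤ v × indexOf v w < e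
  ∈chainW⁻ h = subst (λ x → InRange n _ × x ≤ _ × _ < x) eEq (Ψ.∈chW⁻ h)

  chainW⊆D : ∀ v → v ∈ Ψ.chainW → v ∈ D
  chainW⊆D v h = by-cases (S r ∈? C)
    where
    r = indexOf v w
    rr = proj₁ (Ψ.pidx (proj₁ (∈chainW⁻ h)))
    Wr = proj₂ (Ψ.pidx (proj₁ (∈chainW⁻ h)))
    e≤v = proj₁ (proj₂ (∈chainW⁻ h))
    r<e = proj₂ (proj₂ (∈chainW⁻ h))
    r∉K : r ∉ K
    r∉K h' = <⇒≱ (<-≤-trans r<e (subst (e ≤_) (sym Wr) e≤v)) (proj₂ (Ψ.∈NE⁻ (subst (r ∈_) (sym KwEq) h')))
    rE = ∉K-E rr r∉K
    A[Sr]≡v : A (S r) ≡ v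
    A[Sr]≡v = trans (sym (proj₁ (W-out r rr r∉K))) Wr
    A[Sr]≡ : A (S r) ≡ nextIn n C (S r)
    A[Sr]≡ = trans (A≡ (S r)) (if-¬T (S≢n r (proj₂ rE)))
    by-cases : Dec (S r ∈ C) → v ∈ D
    by-cases (yes Sr∈) = subst (_∈ D) (trans (sym A[Sr]≡) A[Sr]≡v) (nextIn-∈ n e rest (S r) Sr∈)
    by-cases (no Sr∉) = ⊥-elim (Sr∉ (chC (∈chain⁺ (proj₁ rE) r<e (subst (e ≤_) (sym Srv) e≤v) refl)))
      where
      Srv : S r ≡ v
      Srv = trans (sym (trans A[Sr]≡ (nextIn-∉ n C (S r) Sr∉))) A[Sr]≡v

  D⊆chainW : ∀ v → v ∈ D → v ∈ Ψ.chainW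
  D⊆chainW v h = Ψ.∈chW⁺ vR (subst (_≤ v) (sym eEq) (<⇒≤ (e<D h))) (subst₂ _<_ (sym idxv) (sym eEq) r<e)
    where
    x = cycle⁻¹ n e D v
    x∈C : x ∈ C
    x∈C = subst (_∈ C) (sym (if-¬T (λ t' → e∉D (subst (_∈ D) (T-≡ᵇ t') h)))) (prevIn-∈ n e rest v h)
    xd = ∈chain⁻ {e} (Cch x∈C)
    r = proj₁ (proj₂ xd)
    r∈E = proj₁ (proj₂ (proj₂ xd))
    r<e = proj₁ (proj₂ (proj₂ (proj₂ xd)))
    Wr : Ψ.W r ≡ v
    Wr = trans (proj₁ (W-out r (E-R r∈E) (E∉K r∈E)))
               (trans (cong A (proj₂ (proj₂ (proj₂ (proj₂ (proj₂ xd)))))) (trans (A≡ x) (cycle∘cycle⁻¹ v)))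
    idxv : indexOf v w ≡ r
    idxv = trans (cong (λ z → indexOf z w) (sym Wr)) (Ψ.pindexOf r (E-R r∈E))
    vR : InRange n v
    vR = ≤-trans (proj₁ eR) (<⇒≤ (e<D h)) , D≤n h

  chWEq : Ψ.chainW ≡ D
  chWEq = Increasing-ext Ψ.IncchW (AP.tail I) chainW⊆D D⊆chainW

  sigF≡ : ∀ r → Ψ.psiσ-entry r ≡ cycle⁻¹ n e D (Ψ.W (slide⁻¹ K y r))
  sigF≡ r = begin
    Ψ.psiσ-entry r                                      ≡⟨ if-T isCycle-true ⟩
    cycle⁻¹ n Ψ.e Ψ.chainW (Ψ.W (slide⁻¹ Ψ.Kw Ψ.Jw r))  ≡⟨ cong₂ (λ a b → cycle⁻¹ n a b (Ψ.W (slide⁻¹ Ψ.Kw Ψ.Jw r))) eEq chWEq ⟩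
    cycle⁻¹ n e D (Ψ.W (slide⁻¹ Ψ.Kw Ψ.Jw r))           ≡⟨ cong₂ (λ L j → cycle⁻¹ n e D (Ψ.W (slide⁻¹ L j r))) KwEq JEq ⟩
    cycle⁻¹ n e D (Ψ.W (slide⁻¹ K y r))                 ∎
    where open ≡-Reasoning

  sigEq : Ψ.psiσ ≡ σ
  sigEq = sym (at-ext σ m Ψ.psiσ-entry plen pt)
    where
    pt : ∀ i → InRange m i → at σ i ≡ Ψ.psiσ-entry i
    pt i ri = sym (trans (sigF≡ i) (trans (cong (cycle⁻¹ n e D) (wF _ (slide⁻¹-into K-InR i (InRange-suc ri))))
               (trans (cong (λ x → cycle⁻¹ n e D (A (Shat x))) (slide∘slide⁻¹ i))
               (trans (cong (cycle⁻¹ n e D) (A≡ (Shat i))) (trans (cycle⁻¹∘cycle (Shat i)) (Shat-lo i (proj₂ ri)))))))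

  ccEq : Ψ.psiC ≡ c
  ccEq = trans (if-T isCycle-true) (trans (cong₂ (λ L x → suc (exc L) ∸ indexOf x (excLetters L)) sigEq eEq)
           (trans (cong (suc s ∸_) (indexOf-at (Increasing⇒Unique IncEL) dA rdA)) (m∸[m∸n]≡n c≤s')))
    where
    c≤s' : suc c' ≤ suc s
    c≤s' = ≤-trans c≤s (n≤1+n s)




-- φ ∘ ψ = id


module PhiPsi (m : ℕ) (w : List ℕ) (pw : IsPerm (suc m) w) (G : ℕ → ℕ)
             (Ginto : MapsInto (suc m) G) (Ginj : InjectiveOn (suc m) G) (Gn : G (suc m) ≡ suc m)
             (sigG : ∀ r → Psi.psiσ-entry (suc m) w r ≡ G r) where
  private
    module Ψ = PsiFacts m w pw
    n : ℕ
    n = suc m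

  sig≡ : Ψ.psiσ ≡ map G (range1 m)
  sig≡ = map-cong-range1 m Ψ.psiσ-entry G (λ r _ → sigG r)

  psig : IsPerm m Ψ.psiσ
  psig = subst (IsPerm m) (sym sig≡) (IsPerm-restrict m G Ginto Ginj Gn)

  module Σ' = Excedances m Ψ.psiσ psig

  S'≡ : ∀ r → InRange m r → Σ'.S r ≡ G r
  S'≡ r rr = trans (at-map-range1 Ψ.psiσ-entry m r rr) (sigG r)

  Shat'≡ : ∀ x → InRange n x → Σ'.Shat x ≡ G x
  Shat'≡ x rx with m≤n⇒m<n∨m≡n (proj₂ rx)
  ... | inj₁ lt = trans (Σ'.Shat-lo x (≤-pred lt)) (S'≡ x (proj₁ rx , ≤-pred lt))
  ... | inj₂ refl = trans Σ'.Shat-n (sym Gn)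

  K'Eq : ∀ (Q : List ℕ) → Increasing Q → n ∈ Q → (∀ x → x ∈ Q → InRange n x) →
         (∀ r → InRange m r → r ∉ Q → r < Σ'.S r) → (∀ r → InRange m r → r ∈ Q → Σ'.S r ≤ r) → Σ'.K ≡ Q
  K'Eq Q incQ n∈Q QR a b = Increasing-ext Σ'.IncK incQ to from
    where
    to : ∀ x → x ∈ Σ'.K → x ∈ Q
    to x h with Σ'.∈K⁻ h
    ... | inj₂ refl = n∈Q
    ... | inj₁ q with x ∈? Q
    ...   | yes x∈ = x∈
    ...   | no x∉ = ⊥-elim (<⇒≱ (a x (proj₁ (Σ'.∈NE⁻ q)) x∉) (proj₂ (Σ'.∈NE⁻ q)))
    from : ∀ x → x ∈ Q → x ∈ Σ'.K
    from x h with m≤n⇒m<n∨m≡n (proj₂ (QR x h))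
    ... | inj₂ refl = Σ'.n∈K
    ... | inj₁ lt = Σ'.NE⊆K (Σ'.∈NE⁺ rx (b x rx h))
      where
      rx = proj₁ (QR x h) , ≤-pred lt

module PhiPsiSlide (m : ℕ) (w : List ℕ) (pw : IsPerm (suc m) w) (¬cyc : ¬ T (Psi.isCycle (suc m) w)) where
  module Ψ = PsiFacts m w pw
  open Ψ using (n; W; Kp; dB; p; kJ; e; Kw)
  module PiP = Slide Kp n dB Ψ.IncKp Ψ.Lp≥1 Ψ.lastKp Ψ.dBR

  G : ℕ → ℕ
  G r = W (slide⁻¹ Kp dB r)

  Ginto : MapsInto n G
  Ginto = MapsInto-∘ n (slide⁻¹ Kp dB) W (PiP.slide⁻¹-into Ψ.Kp-InR) Ψ.pinto

  Ginj : InjectiveOn n G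
  Ginj = InjectiveOn-∘ n (slide⁻¹ Kp dB) W (PiP.slide⁻¹-into Ψ.Kp-InR) PiP.slide⁻¹-inj Ψ.pinj

  Gn : G n ≡ n
  Gn = trans (cong (λ x → W (slide⁻¹ Kp dB x)) (sym Ψ.lastKp)) (trans (cong W PiP.slide⁻¹-last) (trans (cong W Ψ.atdB) Ψ.Wp))

  sigG : ∀ r → Psi.psiσ-entry n w r ≡ G r
  sigG r = if-¬T ¬cyc

  open PhiPsi m w pw G Ginto Ginj Gn sigG public

  e≤p : p < kJ → e ≤ p
  e≤p lt = ≮⇒≥ (λ p<e → ¬cyc (∧-T (<⇒<ᵇ lt) (<⇒<ᵇ p<e)))

  -- After kJ this is the absence of rises; at kJ it is e ≤ p, which is where ¬ isCycle enters.
  W-next≤ : ∀ i → 1 ≤ i → dB ≤ i → suc i ≤ Ψ.Lp → W (at Kp (suc i)) ≤ at Kp i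
  W-next≤ i i≥1 dB≤i hi = body
    where
    q = at Kp (suc i)
    q∈ = at-∈ Kp (suc i) (s≤s z≤n , hi)
    p≤i : p ≤ at Kp i
    p≤i = subst (_≤ at Kp i) Ψ.atdB (at-mono Ψ.IncKp dB i (proj₁ Ψ.dBR) dB≤i (≤-trans (n≤1+n i) hi))
    iq : at Kp i < q
    iq = at-strictMono Ψ.IncKp i (suc i) i≥1 ≤-refl hi
    p<q : p < q
    p<q = ≤-<-trans p≤i iq
    q∈Kw : q ∈ Kw
    q∈Kw with Ψ.∈Kp⁻ q∈
    ... | rr , inj₁ eq = ⊥-elim (<-irrefl (sym eq) p<q)
    ... | rr , inj₂ le = Ψ.∈NE⁺ rr le
    body : W q ≤ at Kp i
    body with <-cmp kJ q
    ... | tri< lt _ _ with Ψ.fall-after-kJ q q∈Kw lt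
    ...   | q' , q'∈ , q'<q , le = ≤-trans le (<at-suc⇒≤at Ψ.IncKp i q' i≥1 hi (Ψ.Kw⊆Kp q'∈) q'<q)
    body | tri≈ _ eq _ = subst (_≤ at Kp i) (cong W eq) (≤-trans (e≤p (subst (p <_) (sym eq) p<q)) p≤i)
    body | tri> _ _ gt = ⊥-elim (<-asym p<q (<-≤-trans (Ψ.<kJ⇒<e q q∈Kw gt) (e≤p (<-trans p<q gt))))

  a : ∀ r → InRange m r → r ∉ Kp → r < Σ'.S r
  a r rr r∉ = subst (r <_) (sym (trans (S'≡ r rr) (cong W (PiP.slide⁻¹-∉ r r∉))))
               (≰⇒> (λ le → r∉ (Ψ.∈Kp⁺ (InRange-suc rr) (inj₂ le))))

  b : ∀ r → InRange m r → r ∈ Kp → Σ'.S r ≤ r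
  b r rr r∈ with ∈⇒at r∈
  ... | i , ri , eq = subst (λ z → Σ'.S z ≤ z) eq (bAt i ri (subst (InRange m) (sym eq) rr))
    where
    bAt : ∀ i → InRange Ψ.Lp i → InRange m (at Kp i) → Σ'.S (at Kp i) ≤ at Kp i
    bAt i ri rAt with m≤n⇒m<n∨m≡n (proj₂ ri)
    ... | inj₂ e' = ⊥-elim (<-irrefl (trans (cong (at Kp) e') Ψ.lastKp) (s≤s (proj₂ rAt)))
    ... | inj₁ i<L with dB ≤? i
    ...   | yes dB≤i = subst (_≤ at Kp i) (sym (trans (S'≡ _ rAt) (cong W (PiP.slide⁻¹-≥ i ri dB≤i i<L)))) (W-next≤ i (proj₁ ri) dB≤i i<L)
    ...   | no dB≰i = subst (_≤ at Kp i) (sym (trans (S'≡ _ rAt) (cong W (PiP.slide⁻¹-< i ri (≰⇒> dB≰i))))) le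
      where
      le : W (at Kp i) ≤ at Kp i
      le with Ψ.∈Kp⁻ (at-∈ Kp i ri)
      ... | _ , inj₂ l = l
      ... | _ , inj₁ eqp = ⊥-elim (dB≰i (≤-reflexive (sym (at-inj (Increasing⇒Unique Ψ.IncKp) i dB ri Ψ.dBR (trans eqp (sym Ψ.atdB))))))

  KEq : Σ'.K ≡ Kp
  KEq = K'Eq Kp Ψ.IncKp Ψ.n∈Kp Ψ.Kp-InR a b

  LpEq : Ψ.Lp ≡ suc Σ'.t
  LpEq = trans (cong length (sym KEq)) Σ'.lenK

  rdB : InRange (suc Σ'.t) dB
  rdB = subst (λ L → InRange L dB) LpEq Ψ.dBR

  cc≡ : Ψ.psiC ≡ (if p ≡ᵇ n then 0 else Σ'.s + dB)
  cc≡ = if-¬T ¬cyc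

  slideCase : Dec (p ≡ n) → Σ'.SlideCase Ψ.psiC dB
  slideCase (yes pn) = inj₁ (trans (at-inj (Increasing⇒Unique Ψ.IncKp) dB Ψ.Lp Ψ.dBR (Ψ.Lp≥1 , ≤-refl) (trans Ψ.atdB (trans pn (sym Ψ.lastKp)))) LpEq ,
                             trans cc≡ (if-T (≡ᵇ-T pn)))
  slideCase (no pn) = inj₂ (≤-pred (subst (dB <_) LpEq dB<Lp) , trans cc≡ (if-¬T (¬≡ᵇ pn)))
    where
    dB<Lp : dB < Ψ.Lp
    dB<Lp with m≤n⇒m<n∨m≡n (proj₂ Ψ.dBR)
    ... | inj₁ lt = lt
    ... | inj₂ eq = ⊥-elim (pn (trans (sym Ψ.atdB) (trans (cong (at Kp) eq) Ψ.lastKp)))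

  cc≤m : Ψ.psiC ≤ m
  cc≤m = Σ'.SlideCase⇒≤ (slideCase (p ≟ n))

  phiEq : phiDen n Ψ.psiσ Ψ.psiC ≡ w
  phiEq = trans (Σ'.phiDen≡slide Ψ.psiC dB rdB (slideCase (p ≟ n))) (trans (cong (λ L → map (λ r → Σ'.Shat (slide L dB n r)) (range1 n)) KEq)
            (sym (at-ext w n _ Ψ.plen pt)))
    where
    pt : ∀ r → InRange n r → at w r ≡ Σ'.Shat (slide Kp dB n r)
    pt r rr = sym (trans (Shat'≡ _ (PiP.slide-into Ψ.Kp-InR r rr)) (cong W (PiP.slide⁻¹∘slide r)))





module PhiPsiCycle (m : ℕ) (w : List ℕ) (pw : IsPerm (suc m) w) (cyc : T (Psi.isCycle (suc m) w)) where
  module Ψ = PsiFacts m w pw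
  open Ψ using (n; W; Kw; Jw; p; kJ; e; chainW)

  p<kJ : p < kJ
  p<kJ = T-<ᵇ (proj₁ (T-∧ cyc))
  p<e : p < e
  p<e = T-<ᵇ {p} (proj₂ (T-∧ {p <ᵇ kJ} cyc))

  Pc : ℕ → Bool
  Pc v = (e ≤ᵇ v) ∧ (indexOf v w <ᵇ e)

  restW : List ℕ
  restW = filterᵇ Pc (range1 m)

  idx-e : indexOf e w ≡ kJ
  idx-e = Ψ.pindexOf kJ Ψ.kJR

  e∉chW : e ∉ chainW
  e∉chW h = <⇒≱ (proj₂ (proj₂ (Ψ.∈chW⁻ h))) (subst (e ≤_) (sym idx-e) Ψ.e≤kJ)

  n∈chW : n ∈ chainW
  n∈chW = Ψ.∈chW⁺ (s≤s z≤n , ≤-refl) (proj₂ Ψ.eR) (subst (_< e) refl p<e)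

  chW≡ : chainW ≡ restW ++ [ n ]
  chW≡ = Increasing-ext Ψ.IncchW (Increasing-∷ʳ n (Increasing-filterR Pc m) (λ v h → s≤s (proj₂ (proj₁ (∈-filterR⁻ {Pc} {m} h))))) to from
    where
    to : ∀ v → v ∈ chainW → v ∈ restW ++ [ n ]
    to v h with m≤n⇒m<n∨m≡n (proj₂ (proj₁ (Ψ.∈chW⁻ h)))
    ... | inj₂ refl = ∈-snoc-last restW n
    ... | inj₁ lt = ∈-++⁺ˡ (∈-filterR⁺ {Pc} (proj₁ (proj₁ (Ψ.∈chW⁻ h)) , ≤-pred lt) (∧-T (≤⇒≤ᵇ (proj₁ (proj₂ (Ψ.∈chW⁻ h)))) (<⇒<ᵇ (proj₂ (proj₂ (Ψ.∈chW⁻ h))))))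
    from : ∀ v → v ∈ restW ++ [ n ] → v ∈ chainW
    from v h with ∈-snoc⁻ {restW} h
    ... | inj₂ refl = n∈chW
    ... | inj₁ q with ∈-filterR⁻ {Pc} {m} q
    ...   | rr , tt' = Ψ.∈chW⁺ (proj₁ rr , ≤-trans (proj₂ rr) (n≤1+n m)) (T-≤ᵇ (proj₁ (T-∧ tt'))) (T-<ᵇ (proj₂ (T-∧ {e ≤ᵇ v} tt')))

  I' : Increasing (e ∷ restW ++ [ n ])
  I' = All.tabulate lt ∷ subst Increasing chW≡ Ψ.IncchW
    where
    lt : ∀ {v} → v ∈ restW ++ [ n ] → e < v
    lt {v} h = ≤∧≢⇒< (proj₁ (proj₂ (Ψ.∈chW⁻ h'))) (λ eq → e∉chW (subst (_∈ chainW) (sym eq) h'))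
      where
      h' = subst (v ∈_) (sym chW≡) h

  open ChainCycle n e restW I'

  e≥1 : 1 ≤ e
  e≥1 = proj₁ Ψ.eR

  module PiW = Slide Kw n Jw Ψ.IncNE Ψ.L≥1 Ψ.lastKw Ψ.JwR

  Bm : ℕ → ℕ
  Bm = cycle⁻¹ n e D

  G : ℕ → ℕ
  G r = Bm (W (slide⁻¹ Kw Jw r))

  Bm-into : MapsInto n Bm
  Bm-into u r = ChainCycle.cycle⁻¹-into n e restW I' u r e≥1

  B-inj : InjectiveOn n Bm
  B-inj = leftInverse⇒injectiveOn n Bm (cycle n e C) (λ u _ → cycle∘cycle⁻¹ u)

  Ginto : MapsInto n G
  Ginto = MapsInto-∘ n _ Bm (MapsInto-∘ n (slide⁻¹ Kw Jw) W (PiW.slide⁻¹-into Ψ.Kw-InR) Ψ.pinto) Bm-into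

  Ginj : InjectiveOn n G
  Ginj = InjectiveOn-∘ n _ Bm (MapsInto-∘ n (slide⁻¹ Kw Jw) W (PiW.slide⁻¹-into Ψ.Kw-InR) Ψ.pinto)
           (InjectiveOn-∘ n (slide⁻¹ Kw Jw) W (PiW.slide⁻¹-into Ψ.Kw-InR) PiW.slide⁻¹-inj Ψ.pinj) B-inj

  Be : Bm e ≡ n
  Be = if-T (≡ᵇ-T {e} refl)

  Gn : G n ≡ n
  Gn = trans (cong (λ x → Bm (W (slide⁻¹ Kw Jw x))) (sym Ψ.lastKw)) (trans (cong (λ x → Bm (W x)) PiW.slide⁻¹-last) Be)

  sigG : ∀ r → Psi.psiσ-entry n w r ≡ G r
  sigG r = trans (if-T cyc) (cong (λ L → cycle⁻¹ n e L (W (slide⁻¹ Kw Jw r))) chW≡)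

  open PhiPsi m w pw G Ginto Ginj Gn sigG public

  B-fix : ∀ x → x ∈ Kw → x ≢ kJ → Bm (W x) ≡ W x
  B-fix x x∈ ne = trans (if-¬T (λ t' → ne (Ψ.pinj x kJ (Ψ.Kw-InR x x∈) Ψ.kJR (T-≡ᵇ t')))) (prevIn-∉ e D (W x) nin)
    where
    nin : W x ∉ D
    nin h with Ψ.∈chW⁻ (subst (_ ∈_) (sym chW≡) h)
    ... | _ , e≤ , lt = <⇒≱ (<-≤-trans (subst (_< e) (Ψ.pindexOf x (Ψ.Kw-InR x x∈)) lt) e≤) (proj₂ (Ψ.∈NE⁻ x∈))

  B-exc : ∀ r → InRange n r → r ∉ Kw → r < Bm (W r)
  B-exc r rr r∉ with W r ∈? D
  ... | yes h = <-≤-trans r<e (subst (e ≤_) (sym (if-¬T Wr≢e)) (e≤C (prevIn-∈ n e restW (W r) h)))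
    where
    Wr≢e : ¬ T (W r ≡ᵇ e)
    Wr≢e t' = r∉ (subst (_∈ Kw) (Ψ.pinj kJ r Ψ.kJR rr (sym (T-≡ᵇ t'))) Ψ.kJ∈Kw)
    r<e : r < e
    r<e = subst (_< e) (Ψ.pindexOf r rr) (proj₂ (proj₂ (Ψ.∈chW⁻ (subst (_ ∈_) (sym chW≡) h))))
  ... | no h = subst (r <_) (sym (trans (if-¬T Wr≢e) (prevIn-∉ e D (W r) h))) (≰⇒> (λ le → r∉ (Ψ.∈NE⁺ rr le)))
    where
    Wr≢e : ¬ T (W r ≡ᵇ e)
    Wr≢e t' = r∉ (subst (_∈ Kw) (Ψ.pinj kJ r Ψ.kJR rr (sym (T-≡ᵇ t'))) Ψ.kJ∈Kw)

  a : ∀ r → InRange m r → r ∉ Kw → r < Σ'.S r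
  a r rr r∉ = subst (r <_) (sym (trans (S'≡ r rr) (cong (λ x → Bm (W x)) (PiW.slide⁻¹-∉ r r∉)))) (B-exc r (InRange-suc rr) r∉)

  bAt' : ∀ i → InRange Ψ.L i → InRange m (at Kw i) → (i < Ψ.L ⊎ i ≡ Ψ.L) → Dec (Jw ≤ i) → Σ'.S (at Kw i) ≤ at Kw i
  bAt' i ri rAt (inj₂ e') _ = ⊥-elim (<-irrefl (trans (cong (at Kw) e') Ψ.lastKw) (s≤s (proj₂ rAt)))
  bAt' i ri rAt (inj₁ i<L) (yes J≤i) = subst (_≤ at Kw i) (sym (trans (S'≡ (at Kw i) rAt) (trans (cong (λ x → Bm (W x)) (PiW.slide⁻¹-≥ i ri J≤i i<L)) (B-fix (at Kw (suc i)) q∈ qne))))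
                        (Ψ.fall->Jw (suc i) (s≤s J≤i) i<L)
      where
      q∈ = at-∈ Kw (suc i) (s≤s z≤n , i<L)
      qne : at Kw (suc i) ≢ kJ
      qne eq' = <-irrefl (at-inj (Increasing⇒Unique Ψ.IncNE) Jw (suc i) Ψ.JwR (s≤s z≤n , i<L) (sym eq')) (s≤s J≤i)
  bAt' i ri rAt (inj₁ i<L) (no J≰i) = subst (_≤ at Kw i) (sym (trans (S'≡ (at Kw i) rAt) (trans (cong (λ x → Bm (W x)) (PiW.slide⁻¹-< i ri (≰⇒> J≰i))) (B-fix (at Kw i) (at-∈ Kw i ri) qne))))
                        (proj₂ (Ψ.∈NE⁻ (at-∈ Kw i ri)))
      where
      qne : at Kw i ≢ kJ
      qne eq' = J≰i (≤-reflexive (at-inj (Increasing⇒Unique Ψ.IncNE) Jw i Ψ.JwR ri (sym eq')))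

  bAt : ∀ i → InRange Ψ.L i → InRange m (at Kw i) → Σ'.S (at Kw i) ≤ at Kw i
  bAt i ri rAt = bAt' i ri rAt (m≤n⇒m<n∨m≡n (proj₂ ri)) (Jw ≤? i)

  b : ∀ r → InRange m r → r ∈ Kw → Σ'.S r ≤ r
  b r rr r∈ = subst (λ z → Σ'.S z ≤ z) (proj₂ (proj₂ (∈⇒at r∈))) (bAt (proj₁ (∈⇒at r∈)) (proj₁ (proj₂ (∈⇒at r∈))) (subst (InRange m) (sym (proj₂ (proj₂ (∈⇒at r∈)))) rr))

  KEq : Σ'.K ≡ Kw
  KEq = K'Eq Kw Ψ.IncNE Ψ.n∈Kw Ψ.Kw-InR a b

  E'∉Kw' : ∀ {i} → i ∈ Σ'.E → (i ∈ Σ'.NE ⊎ i ≡ n) → ⊥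
  E'∉Kw' h (inj₁ q) = <⇒≱ (proj₂ (Σ'.∈E⁻ h)) (proj₂ (Σ'.∈NE⁻ q))
  E'∉Kw' h (inj₂ eq) = <-irrefl eq (s≤s (proj₂ (proj₁ (Σ'.∈E⁻ h))))

  E'∉Kw : ∀ {i} → i ∈ Σ'.E → i ∉ Kw
  E'∉Kw {i} h h' = E'∉Kw' h (Σ'.∈K⁻ (subst (i ∈_) (sym KEq) h'))

  module Pos (v : ℕ) (v∈D : v ∈ D) where
    vc = Ψ.∈chW⁻ (subst (v ∈_) (sym chW≡) v∈D)
    i = indexOf v w
    isp = Ψ.pidx (proj₁ vc)
    iR : InRange n i
    iR = proj₁ isp
    Wi : W i ≡ v
    Wi = proj₂ isp
    i<e : i < e
    i<e = proj₂ (proj₂ vc)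
    i∉Kw : i ∉ Kw
    i∉Kw h = <⇒≱ (<-≤-trans i<e (subst (e ≤_) (sym Wi) (proj₁ (proj₂ vc)))) (proj₂ (Ψ.∈NE⁻ h))
    im : InRange m i
    im = proj₁ iR , ≤-pred (<-≤-trans i<e (proj₂ Ψ.eR))
    S'i : Σ'.S i ≡ Bm v
    S'i = trans (S'≡ i im) (trans (cong (λ x → Bm (W x)) (PiW.slide⁻¹-∉ i i∉Kw)) (cong Bm Wi))

  e≢n : ¬ T (e ≡ᵇ n)
  e≢n t' = <-irrefl (Ψ.pinj p kJ Ψ.pR Ψ.kJR (trans Ψ.Wp (sym (T-≡ᵇ t')))) p<kJ

  u1 : ℕ
  u1 = cycle n e C e
  u1∈D : u1 ∈ D
  u1∈D = subst (_∈ D) (sym (if-¬T e≢n)) (nextIn-∈ n e restW e (here refl))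

  module Posₑ = Pos u1 u1∈D
  iₑ : ℕ
  iₑ = Posₑ.i

  Siₑ : Σ'.S iₑ ≡ e
  Siₑ = trans Posₑ.S'i (cycle⁻¹∘cycle e)

  iₑ∈E' : iₑ ∈ Σ'.E
  iₑ∈E' = Σ'.∈E⁺ Posₑ.im (subst (iₑ <_) (sym Siₑ) Posₑ.i<e)

  e∈EL' : e ∈ Σ'.EL
  e∈EL' = Σ'.∈EL⁺ iₑ∈E' Siₑ

  dA' : ℕ
  dA' = indexOf e Σ'.EL
  dsp : InRange (length Σ'.EL) dA' × at Σ'.EL dA' ≡ e
  dsp = indexOf-∈ e∈EL'
  rdA' : InRange Σ'.s dA'
  rdA' = subst (λ L → InRange L dA') Σ'.lenEL (proj₁ dsp)

  c' : ℕ
  c' = Σ'.s ∸ dA'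

  c≤s : suc c' ≤ Σ'.s
  c≤s = suc[s∸d]≤s dA' Σ'.s (proj₁ rdA') (proj₂ rdA')
    where
    suc[s∸d]≤s : ∀ d s → 1 ≤ d → d ≤ s → suc (s ∸ d) ≤ s
    suc[s∸d]≤s (suc d') (suc s') _ _ = s≤s (m∸n≤m s' d')

  ccEq : Ψ.psiC ≡ suc c'
  ccEq = trans (if-T cyc) (+-∸-assoc 1 (proj₂ rdA'))

  module CA' = CycleCase m Ψ.psiσ psig c' c≤s

  dAEq : CA'.dA ≡ dA'
  dAEq = m∸[m∸n]≡n (proj₂ rdA')

  eEq : CA'.e ≡ e
  eEq = trans (cong (at Σ'.EL) dAEq) (proj₂ dsp)

  toC' : ∀ i → i ∈ Σ'.E → i < e → e ≤ Σ'.S i → Dec (W i ∈ D) → Σ'.S i ∈ C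
  toC' i i∈ i<e e≤ (yes h') = subst (_∈ C) (sym (trans S'i (if-¬T Wi≢e))) (prevIn-∈ n e restW (W i) h')
    where
    iR : InRange n i
    iR = InRange-suc (proj₁ (Σ'.∈E⁻ i∈))
    i∉ = E'∉Kw i∈
    S'i : Σ'.S i ≡ Bm (W i)
    S'i = trans (S'≡ i (proj₁ (Σ'.∈E⁻ i∈))) (cong (λ x → Bm (W x)) (PiW.slide⁻¹-∉ i i∉))
    Wi≢e : ¬ T (W i ≡ᵇ e)
    Wi≢e t' = i∉ (subst (_∈ Kw) (Ψ.pinj kJ i Ψ.kJR iR (sym (T-≡ᵇ t'))) Ψ.kJ∈Kw)
  toC' i i∈ i<e e≤ (no h') = ⊥-elim (h' (subst (_ ∈_) chW≡ (Ψ.∈chW⁺ (Ψ.pinto i iR) (subst (e ≤_) S'iW e≤) (subst (_< e) (sym (Ψ.pindexOf i iR)) i<e))))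
    where
    iR : InRange n i
    iR = InRange-suc (proj₁ (Σ'.∈E⁻ i∈))
    i∉ = E'∉Kw i∈
    S'i : Σ'.S i ≡ Bm (W i)
    S'i = trans (S'≡ i (proj₁ (Σ'.∈E⁻ i∈))) (cong (λ x → Bm (W x)) (PiW.slide⁻¹-∉ i i∉))
    Wi≢e : ¬ T (W i ≡ᵇ e)
    Wi≢e t' = i∉ (subst (_∈ Kw) (Ψ.pinj kJ i Ψ.kJR iR (sym (T-≡ᵇ t'))) Ψ.kJ∈Kw)
    S'iW : Σ'.S i ≡ W i
    S'iW = trans S'i (trans (if-¬T Wi≢e) (prevIn-∉ e D (W i) h'))

  chainEq : Σ'.chain e ≡ C
  chainEq = Increasing-ext (Σ'.Incchain e) (Increasing-++⁻ˡ {e ∷ restW} I') to from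
    where
    to : ∀ v → v ∈ Σ'.chain e → v ∈ C
    to v h = subst (_∈ C) (proj₂ (proj₂ (proj₂ (proj₂ (proj₂ cd)))))
               (toC' (proj₁ (proj₂ cd)) (proj₁ (proj₂ (proj₂ cd))) (proj₁ (proj₂ (proj₂ (proj₂ cd)))) (proj₁ (proj₂ (proj₂ (proj₂ (proj₂ cd))))) (W (proj₁ (proj₂ cd)) ∈? D))
      where
      cd = Σ'.∈chain⁻ {e} h
    from : ∀ v → v ∈ C → v ∈ Σ'.chain e
    from v (here refl) = Σ'.∈chain⁺ iₑ∈E' Posₑ.i<e (≤-reflexive (sym Siₑ)) Siₑ
    from v (there h) = Σ'.∈chain⁺ iE' Pv.i<e (subst (e ≤_) (sym S'iv) (<⇒≤ (e<D (∈-++⁺ˡ h)))) S'iv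
      where
      vn : ¬ T (v ≡ᵇ n)
      vn t' = <-irrefl (T-≡ᵇ t') (rest<n h)
      u = cycle n e C v
      u∈D : u ∈ D
      u∈D = subst (_∈ D) (sym (if-¬T vn)) (nextIn-∈ n e restW v (there h))
      module Pv = Pos u u∈D
      S'iv : Σ'.S Pv.i ≡ v
      S'iv = trans Pv.S'i (cycle⁻¹∘cycle v)
      iE' : Pv.i ∈ Σ'.E
      iE' = Σ'.∈E⁺ Pv.im (subst (Pv.i <_) (sym S'iv) (<-trans Pv.i<e (e<D (∈-++⁺ˡ h))))

  yEq : CA'.y ≡ Jw
  yEq = trans (cong₂ firstGeq eEq KEq) (firstGeq-≡ Ψ.IncNE e Jw Ψ.JwR (T-<ᵇ Ψ.rise-Jw) Ψ.e≤kJ)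

  AEq : ∀ x → CA'.A x ≡ cycle n e C x
  AEq x = trans (cong (λ z → cycle n z (Σ'.chain z) x) eEq) (cong (λ L → cycle n e L x) chainEq)

  phiEq : phiDen n Ψ.psiσ Ψ.psiC ≡ w
  phiEq = trans (cong (phiDen n Ψ.psiσ) ccEq) (trans CA'.phiDen≡cycle∘slide (sym (at-ext w n _ Ψ.plen pt)))
    where
    pt : ∀ r → InRange n r → at w r ≡ CA'.A (Σ'.Shat (slide Σ'.K CA'.y n r))
    pt r rr = sym (trans (AEq _) (trans (cong (λ z → cycle n e C (Σ'.Shat z)) (cong₂ (λ L j → slide L j n r) KEq yEq))
               (trans (cong (cycle n e C) (Shat'≡ _ (PiW.slide-into Ψ.Kw-InR r rr)))
               (trans (cong (λ x → cycle n e C (Bm (W x))) (PiW.slide⁻¹∘slide r)) (cycle∘cycle⁻¹ (W r))))))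

  cc≤m : Ψ.psiC ≤ m
  cc≤m = subst (_≤ m) (sym ccEq) (≤-trans c≤s Σ'.s≤m)

psi∘phiDen : ∀ m σ c → IsPerm m σ → c ≤ m →
             Psi.psiσ (suc m) (phiDen (suc m) σ c) ≡ σ × Psi.psiC (suc m) (phiDen (suc m) σ c) ≡ c
psi∘phiDen m σ c pσ c≤m with Excedances.c-cases m σ pσ c c≤m
... | inj₁ (c' , refl , c≤s) = PsiPhiCycle.sigEq m σ pσ c' c≤s w pw w≡ , PsiPhiCycle.ccEq m σ pσ c' c≤s w pw w≡
  where
  w = phiDen (suc m) σ c
  pw = phiDen-isPerm m σ c pσ c≤m
  w≡ = λ r rr → trans (cong (λ L → at L r) (CycleCase.phiDen≡cycle∘slide m σ pσ c' c≤s)) (at-map-range1 _ (suc m) r rr)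
... | inj₂ (d , rd , sc) = PsiPhiSlide.sigEq m σ pσ c d rd sc w pw w≡ , PsiPhiSlide.ccEq m σ pσ c d rd sc w pw w≡
  where
  w = phiDen (suc m) σ c
  pw = phiDen-isPerm m σ c pσ c≤m
  w≡ = λ r rr → trans (cong (λ L → at L r) (Excedances.phiDen≡slide m σ pσ c d rd sc)) (at-map-range1 _ (suc m) r rr)

phiDen∘psi : ∀ m w → IsPerm (suc m) w →
             IsPerm m (Psi.psiσ (suc m) w) × Psi.psiC (suc m) w ≤ m × phiDen (suc m) (Psi.psiσ (suc m) w) (Psi.psiC (suc m) w) ≡ w
phiDen∘psi m w pw with T? (Psi.isCycle (suc m) w)
... | yes cyc = PhiPsiCycle.psig m w pw cyc , PhiPsiCycle.cc≤m m w pw cyc , PhiPsiCycle.phiEq m w pw cyc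
... | no ¬cyc = PhiPsiSlide.psig m w pw ¬cyc , PhiPsiSlide.cc≤m m w pw ¬cyc , PhiPsiSlide.phiEq m w pw ¬cyc

lemma2p3 : (n : ℕ) → 1 ≤ n →
    ((σ : List ℕ) (c : ℕ) → IsPerm (n ∸ 1) σ → c ≤ n ∸ 1 → IsPerm n (phiDen n σ c))
    × ((σ τ : List ℕ) (c c′ : ℕ) → IsPerm (n ∸ 1) σ → IsPerm (n ∸ 1) τ → c ≤ n ∸ 1 → c′ ≤ n ∸ 1 →
        phiDen n σ c ≡ phiDen n τ c′ → (σ ≡ τ) × (c ≡ c′))
    × ((w : List ℕ) → IsPerm n w →
        ∃[ σ ] ∃[ c ] (IsPerm (n ∸ 1) σ × c ≤ n ∸ 1 × phiDen n σ c ≡ w))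
lemma2p3 (suc m) _ = phiDen-isPerm m , injective , surjective
  where
  injective : ∀ σ τ c c′ → IsPerm m σ → IsPerm m τ → c ≤ m → c′ ≤ m →
              phiDen (suc m) σ c ≡ phiDen (suc m) τ c′ → (σ ≡ τ) × (c ≡ c′)
  injective σ τ c c′ pσ pτ c≤m c′≤m eq =
    trans (sym (proj₁ ψφ[σ,c])) (trans (cong (Psi.psiσ (suc m)) eq) (proj₁ ψφ[τ,c′])) ,
    trans (sym (proj₂ ψφ[σ,c])) (trans (cong (Psi.psiC (suc m)) eq) (proj₂ ψφ[τ,c′]))
    where
    ψφ[σ,c] = psi∘phiDen m σ c pσ c≤m
    ψφ[τ,c′] = psi∘phiDen m τ c′ pτ c′≤m
  surjective : ∀ w → IsPerm (suc m) w → ∃[ σ ] ∃[ c ] (IsPerm m σ × c ≤ m × phiDen (suc m) σ c ≡ w)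
  surjective w pw = Psi.psiσ (suc m) w , Psi.psiC (suc m) w , phiDen∘psi m w pw
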